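{- Let $n\ge 4$, $N=\{1,\dots,n\}$, let $i_1,i_2\in N$ with $i_1\ne i_2$, and let $\hat N^c=N\setminus\{i_1,i_2\}$. Then the inequality $$\sum_{j\in\hat N^c}\left(x_{i_1j}+x_{ji_1}+x_{ji_2}\right)-x_{i_1i_2}-\sum_{j,j'\in\hat N^c:\ j\ne j'} x_{jj'}\ \le\ 3-\frac{(n-4)(n-5)}{2}$$ is facet defining for the weak order polytope $P^n_{WO}$.
   Context: Let $N=\{1,\dots,n\}$ and $A_N=\{(i,j): i,j\in N,\ i\ne j\}$. A weak order on $N$ is a binary relation $W\subseteq N\times N$ that is reflexive, transitive and total; $(i,j)\in W$ is read "$i$ is preferred over or tied with $j$". The characteristic vector of $W$ is $x^W\in\{0,1\}^{A_N}$ with $x^W_{ij}=1$ if $(i,j)\in W$ and $0$ otherwise. The weak order polytope $P^n_{WO}\subseteq\mathbb{R}^{A_N}$ is the convex hull of the characteristic vectors of all weak orders on $N$. An inequality $\pi x\le \pi_0$ is facet defining for a polytope $P$ if it is valid for $P$ and the face $P\cap\{x:\pi x=\pi_0\}$ is nonempty, different from $P$, and has dimension $\dim(P)-1$ (here $\dim P^n_{WO}=n(n-1)$).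
   Formalization: Points of $P^n_{WO}$ have rational rather than real coordinates and are rational convex combinations of characteristic vectors, so validity, the face and affine dimensions are taken over ℚ. -}

module Defs where

open import Data.Nat as ℕ using (ℕ; zero; suc; _∸_)
open import Data.Fin using (Fin; zero; suc; _≟_)
open import Data.Bool using (Bool; true; false; if_then_else_; _∧_; not)
open import Data.Integer using (+_)
open import Data.Rational using (ℚ; 0ℚ; 1ℚ; _+_; _*_; _-_; _≤_; _/_)
open import Data.Product using (Σ; ∃; _×_; _,_)
open import Data.Sum using (_⊎_)
open import Relation.Nullary using (¬_)
open import Relation.Nullary.Decidable using (⌊_⌋)
open import Relation.Binary.PropositionalEquality using (_≡_)

sumFin : ∀ {k} → (Fin k → ℚ) → ℚ
sumFin {zero}  f = 0ℚ
sumFin {suc k} f = f zero + sumFin (λ t → f (suc t))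

-- Coordinates are indexed by ordered pairs (i,j);
-- only the off-diagonal coordinates (i ≠ j), i.e. A_N, are meaningful; every point
-- of the polytope has zero diagonal (see charVec), so this is an isometric copy of
-- ℚ^{A_N} and affine dimensions are unchanged.
Point : ℕ → Set
Point n = Fin n → Fin n → ℚ

record WeakOrder (n : ℕ) : Set where
  field
    rel   : Fin n → Fin n → Bool
    refl  : ∀ i → rel i i ≡ true
    trans : ∀ i j k → rel i j ≡ true → rel j k ≡ true → rel i k ≡ true
    total : ∀ i j → rel i j ≡ true ⊎ rel j i ≡ true

-- Characteristic vector x^W (diagonal set to 0, since (i,i) ∉ A_N).
charVec : ∀ {n} → WeakOrder n → Point n
charVec W i j =
  if ⌊ i ≟ j ⌋ then 0ℚ
  else (if WeakOrder.rel W i j then 1ℚ else 0ℚ)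

InPWO : (n : ℕ) → Point n → Set
InPWO n x =
  Σ ℕ λ k → Σ (Fin k → ℚ) λ lam → Σ (Fin k → WeakOrder n) λ W →
    (∀ t → 0ℚ ≤ lam t) × (sumFin lam ≡ 1ℚ) ×
    (∀ i j → x i j ≡ sumFin (λ t → lam t * charVec (W t) i j))

AffinelyIndependent : ∀ {n m} → (Fin m → Point n) → Set
AffinelyIndependent {n} {m} p =
  (lam : Fin m → ℚ) → sumFin lam ≡ 0ℚ →
  (∀ i j → sumFin (λ t → lam t * p t i j) ≡ 0ℚ) →
  ∀ t → lam t ≡ 0ℚ

HasDim : ∀ {n} → (Point n → Set) → ℕ → Set
HasDim {n} S d =
  (Σ (Fin (suc d) → Point n) λ p → (∀ t → S (p t)) × AffinelyIndependent p) ×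
  (∀ (p : Fin (suc (suc d)) → Point n) → (∀ t → S (p t)) → ¬ AffinelyIndependent p)

FacetDefining : ∀ {n} → (Point n → Set) → (Point n → ℚ) → ℚ → Set
FacetDefining {n} P f b =
  (∀ x → P x → f x ≤ b) ×
  (∃ λ x → P x × f x ≡ b) ×
  ¬ (∀ x → P x → f x ≡ b) ×
  (∃ λ d → HasDim P (suc d) × HasDim (λ x → P x × f x ≡ b) d)

outside : ∀ {n} → Fin n → Fin n → Fin n → Bool
outside i₁ i₂ j = not ⌊ j ≟ i₁ ⌋ ∧ not ⌊ j ≟ i₂ ⌋

lhs13 : ∀ {n} → Fin n → Fin n → Point n → ℚ
lhs13 i₁ i₂ x =
  sumFin (λ j → if outside i₁ i₂ j then x i₁ j + x j i₁ + x j i₂ else 0ℚ)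
  - x i₁ i₂
  - sumFin (λ j → sumFin (λ j' →
      if outside i₁ i₂ j ∧ outside i₁ i₂ j' ∧ not ⌊ j ≟ j' ⌋ then x j j' else 0ℚ))

-- Right-hand side 3 - (n-4)(n-5)/2  (n ≥ 4, so truncated subtraction is harmless:
-- for n = 4 the product is 0 either way).
rhs13 : ℕ → ℚ
rhs13 n = (+ 3 / 1) - (+ ((n ∸ 4) ℕ.* (n ∸ 5)) / 2)

-- For the vector x of a weak order, with outsiders j, j′ ∉ {a, b},
--   lhs = rhs + Σⱼ (x_aj + x_ja + x_jb - 2) - x_ab - ½ Σ_{j≠j′} (x_jj′ + x_j′j - 1).
-- The pair slacks are ≥ 0 by totality.  If a is not above b, no j sits between them and every
-- head slack is ≤ 0.  Otherwise a head slack is positive only for the t outsiders tied with a,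
-- which are pairwise tied, so lhs ≤ rhs + t - 1 - t(t-1)/2 ≤ rhs.
--
-- Lift each point to (1, its coordinates); affine independence becomes linear
-- independence, and Gaussian elimination over a finite family of weak orders either finds a
-- basis or a nonzero functional vanishing on all of them.  Such a functional is killed
-- coordinate by coordinate using pairs of weak orders, prescribed on four pivots a, b, j, k
-- with all other elements ranked above them, whose vectors differ in one or two coordinates.
-- On the face the coordinate x_ab is dropped, as the equation determines it from the others,
-- and all orders used satisfy the inequality with equality.

module Submission where

open import Defs
open import Data.Nat as ℕ using (ℕ; zero; suc; z≤n; s≤s)
import Data.Nat.Properties as ℕP
open import Data.Fin as F using (Fin; zero; suc; toℕ)
import Data.Fin.Properties as FP
open import Data.Bool using (Bool; true; false; if_then_else_; _∧_; _∨_; not; T)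
import Data.Bool
open import Data.Bool.Properties using (T-≡)
open import Data.Maybe using (Maybe; just; nothing; maybe)
import Data.Maybe.Properties as MaybeP
import Data.Integer as ℤ
open import Data.Rational as ℚ using (ℚ; 0ℚ; 1ℚ; ½; _+_; _*_; _-_; -_; _≤_; _/_; 1/_)
import Data.Rational.Properties as ℚP
import Data.Rational.Unnormalised as ℚᵘ
import Data.Rational.Unnormalised.Properties as ℚᵘP
open import Data.Rational.Solver using (module +-*-Solver)
open import Data.Product using (Σ; ∃; ∃₂; _×_; _,_; proj₁; proj₂; uncurry)
open import Data.Product.Properties using (,-injectiveˡ; ,-injectiveʳ; ≡-dec)
open import Data.Sum using (_⊎_; inj₁; inj₂)
import Data.Sum
open import Data.Empty using (⊥; ⊥-elim)
open import Data.List using (List; []; _∷_)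
import Data.List
open import Data.List.Relation.Unary.All using (All; []; _∷_)
open import Data.Vec using (Vec; []; _∷_; lookup)
import Data.Vec.Functional as VF
open import Data.Vec.Relation.Unary.Unique.Propositional using (Unique; []; _∷_)
open import Data.Vec.Relation.Unary.AllPairs using (allPairs?)
import Data.Vec.Relation.Unary.All as VecAll
open import Data.Vec.Relation.Unary.Unique.Propositional.Properties using (lookup-injective)
open import Algebra.Bundles using (CommutativeRing)
open import Function using (_∘_; _⇔_; Equivalence; mk⇔)
open import Function.Definitions using (Injective)
open import Relation.Nullary using (¬_; ¬?; Dec; yes; no)
open import Relation.Nullary.Decidable using (map′; _×-dec_; _→-dec_; ⌊_⌋; True; toWitness; fromWitness; from-yes; decidable-stable)
open import Relation.Binary.PropositionalEquality hiding (J)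
open import Relation.Binary.Definitions using (tri<; tri≈; tri>)

open +-*-Solver

ι : Bool → ℚ
ι b = if b then 1ℚ else 0ℚ

sumFin-cong : ∀ {k} {f g : Fin k → ℚ} → (∀ t → f t ≡ g t) → sumFin f ≡ sumFin g
sumFin-cong {zero}  f≗g = refl
sumFin-cong {suc k} f≗g = cong₂ _+_ (f≗g zero) (sumFin-cong (f≗g ∘ suc))

sumFin-zero : ∀ {k} {f : Fin k → ℚ} → (∀ t → f t ≡ 0ℚ) → sumFin f ≡ 0ℚ
sumFin-zero {zero}  f≗0 = refl
sumFin-zero {suc k} f≗0 = cong₂ _+_ (f≗0 zero) (sumFin-zero (f≗0 ∘ suc))

module _ where
  open import Algebra.Properties.Semiring.Sum (CommutativeRing.semiring ℚP.+-*-commutativeRing)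
    using (sum; ∑-distrib-+; ∑-comm; *-distribˡ-sum)

  private
    sumFin≡sum : ∀ {k} (f : Fin k → ℚ) → sumFin f ≡ sum f
    sumFin≡sum {zero}  f = refl
    sumFin≡sum {suc k} f = cong (f zero +_) (sumFin≡sum (f ∘ suc))

  sumFin-+ : ∀ {k} (f g : Fin k → ℚ) → sumFin (λ t → f t + g t) ≡ sumFin f + sumFin g
  sumFin-+ f g = begin
    sumFin (λ t → f t + g t) ≡⟨ sumFin≡sum (λ t → f t + g t) ⟩
    sum (λ t → f t + g t)    ≡⟨ ∑-distrib-+ f g ⟩
    sum f + sum g            ≡⟨ cong₂ _+_ (sumFin≡sum f) (sumFin≡sum g) ⟨
    sumFin f + sumFin g      ∎
    where open ≡-Reasoning

  sumFin-comm : ∀ {k m} (f : Fin k → Fin m → ℚ) →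
    sumFin (λ i → sumFin (f i)) ≡ sumFin (λ j → sumFin (λ i → f i j))
  sumFin-comm f = begin
    sumFin (λ i → sumFin (f i))          ≡⟨ sumFin-cong (λ i → sumFin≡sum (f i)) ⟩
    sumFin (λ i → sum (f i))             ≡⟨ sumFin≡sum (λ i → sum (f i)) ⟩
    sum (λ i → sum (f i))                ≡⟨ ∑-comm f ⟩
    sum (λ j → sum (λ i → f i j))        ≡⟨ sumFin≡sum (λ j → sum (λ i → f i j)) ⟨
    sumFin (λ j → sum (λ i → f i j))     ≡⟨ sumFin-cong (λ j → sumFin≡sum (λ i → f i j)) ⟨
    sumFin (λ j → sumFin (λ i → f i j))  ∎
    where open ≡-Reasoning

  sumFin-*ˡ : ∀ {k} (c : ℚ) (f : Fin k → ℚ) → sumFin (λ t → c * f t) ≡ c * sumFin f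
  sumFin-*ˡ c f = begin
    sumFin (λ t → c * f t) ≡⟨ sumFin≡sum (λ t → c * f t) ⟩
    sum (λ t → c * f t)    ≡⟨ *-distribˡ-sum c f ⟨
    c * sum f              ≡⟨ cong (c *_) (sumFin≡sum f) ⟨
    c * sumFin f           ∎
    where open ≡-Reasoning

sumFin-*ʳ : ∀ {k} (c : ℚ) (f : Fin k → ℚ) → sumFin (λ t → f t * c) ≡ sumFin f * c
sumFin-*ʳ c f = begin
  sumFin (λ t → f t * c) ≡⟨ sumFin-cong (λ t → ℚP.*-comm (f t) c) ⟩
  sumFin (λ t → c * f t) ≡⟨ sumFin-*ˡ c f ⟩
  c * sumFin f           ≡⟨ ℚP.*-comm c _ ⟩
  sumFin f * c           ∎
  where open ≡-Reasoning

sumFin-neg : ∀ {k} (f : Fin k → ℚ) → sumFin (λ t → - f t) ≡ - sumFin f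
sumFin-neg {zero}  f = refl
sumFin-neg {suc k} f =
  trans (cong (- f zero +_) (sumFin-neg (f ∘ suc))) (sym (ℚP.neg-distrib-+ (f zero) _))

sumFin-sub : ∀ {k} (f g : Fin k → ℚ) → sumFin (λ t → f t - g t) ≡ sumFin f - sumFin g
sumFin-sub f g = trans (sumFin-+ f (λ t → - g t)) (cong (sumFin f +_) (sumFin-neg g))

sumFin-single : ∀ {k} (f : Fin k → ℚ) (i : Fin k) → (∀ t → t ≢ i → f t ≡ 0ℚ) → sumFin f ≡ f i
sumFin-single f zero    f≗0 =
  trans (cong (f zero +_) (sumFin-zero (λ t → f≗0 (suc t) λ ()))) (ℚP.+-identityʳ (f zero))
sumFin-single f (suc i) f≗0 =
  trans (cong₂ _+_ (f≗0 zero λ ()) (sumFin-single (f ∘ suc) i (λ t t≢i → f≗0 (suc t) (t≢i ∘ FP.suc-injective))))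
        (ℚP.+-identityˡ (f (suc i)))

sumFin-pair : ∀ {k} (f : Fin k → ℚ) {i j} → i ≢ j → (∀ t → t ≢ i → t ≢ j → f t ≡ 0ℚ) → sumFin f ≡ f i + f j
sumFin-pair f {zero}  {zero}  0≢0 f≗0 = ⊥-elim (0≢0 refl)
sumFin-pair f {zero}  {suc j} _   f≗0 =
  cong (f zero +_) (sumFin-single (f ∘ suc) j λ t t≢j → f≗0 (suc t) (λ ()) (t≢j ∘ FP.suc-injective))
sumFin-pair f {suc i} {zero}  _   f≗0 = trans (ℚP.+-comm (f zero) _)
  (cong (_+ f zero) (sumFin-single (f ∘ suc) i λ t t≢i → f≗0 (suc t) (t≢i ∘ FP.suc-injective) (λ ())))
sumFin-pair f {suc i} {suc j} i≢j f≗0 = trans (cong₂ _+_ (f≗0 zero (λ ()) (λ ())) (sumFin-pair (f ∘ suc) (i≢j ∘ cong suc)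
  λ t t≢i t≢j → f≗0 (suc t) (t≢i ∘ FP.suc-injective) (t≢j ∘ FP.suc-injective))) (ℚP.+-identityˡ _)

sumFin-mono : ∀ {k} (f g : Fin k → ℚ) → (∀ t → f t ≤ g t) → sumFin f ≤ sumFin g
sumFin-mono {zero}  f g f≤g = ℚP.≤-refl
sumFin-mono {suc k} f g f≤g = ℚP.+-mono-≤ (f≤g zero) (sumFin-mono (f ∘ suc) (g ∘ suc) (f≤g ∘ suc))

δ : ∀ {k} → Fin k → Fin k → ℚ
δ i s = ι ⌊ s F.≟ i ⌋

sumFin-δ : ∀ {k} (i : Fin k) (g : Fin k → ℚ) → sumFin (λ s → δ i s * g s) ≡ g i
sumFin-δ i g = trans (sumFin-single (λ s → δ i s * g s) i off) on
  where
  off : ∀ s → s ≢ i → δ i s * g s ≡ 0ℚ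
  off s s≢i with s F.≟ i
  ... | yes s≡i = ⊥-elim (s≢i s≡i)
  ... | no _    = ℚP.*-zeroˡ (g s)
  on : δ i i * g i ≡ g i
  on with i F.≟ i
  ... | yes _   = ℚP.*-identityˡ (g i)
  ... | no i≢i  = ⊥-elim (i≢i refl)

-- Linear independence over ℚ, by Gaussian elimination

Searchable : Set → Set₁
Searchable I = ∀ (P : I → Set) → (∀ i → Dec (P i)) → Σ I P ⊎ (∀ i → ¬ P i)

searchable-Fin : ∀ {k} → Searchable (Fin k)
searchable-Fin P P? with FP.any? P?
... | yes found = inj₁ found
... | no none   = inj₂ λ i p → none (i , p)

searchable-× : ∀ {A B : Set} → Searchable A → Searchable B → Searchable (A × B)
searchable-× {A} {B} search-A search-B P P? with search-A (λ a → Σ B λ b → P (a , b)) P-at?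
  where
  P-at? : ∀ a → Dec (Σ B λ b → P (a , b))
  P-at? a with search-B (λ b → P (a , b)) (λ b → P? (a , b))
  ... | inj₁ found = yes found
  ... | inj₂ none  = no λ (b , p) → none b p
... | inj₁ (a , b , p) = inj₁ ((a , b) , p)
... | inj₂ none        = inj₂ λ (a , b) p → none a (b , p)

searchable-Bool : Searchable Bool
searchable-Bool P P? with P? true | P? false
... | yes p | _     = inj₁ (true , p)
... | no _  | yes p = inj₁ (false , p)
... | no ¬t | no ¬f = inj₂ λ { true → ¬t ; false → ¬f }

searchable-True : ∀ {A : Set} {P : A → Set} → Searchable A → (P? : ∀ x → Dec (P x)) → Searchable (Σ A (True ∘ P?))
searchable-True {A} {P} search-A P? Q Q? with search-A (λ x → Σ (True (P? x)) λ t → Q (x , t)) Q-at?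
  where
  Σ-T? : ∀ b {R : T b → Set} → (∀ t → Dec (R t)) → Dec (Σ (T b) R)
  Σ-T? true  R? = map′ (_ ,_) proj₂ (R? _)
  Σ-T? false R? = no proj₁
  Q-at? : ∀ x → Dec (Σ (True (P? x)) λ t → Q (x , t))
  Q-at? x = Σ-T? ⌊ P? x ⌋ (λ t → Q? (x , t))
... | inj₁ (x , t , q) = inj₁ ((x , t) , q)
... | inj₂ none        = inj₂ λ (x , t) q → none x (t , q)

Independent : ∀ {m D} → (Fin m → Fin D → ℚ) → Set
Independent {m} u = ∀ (μ : Fin m → ℚ) → (∀ r → sumFin (λ s → μ s * u s r) ≡ 0ℚ) → ∀ s → μ s ≡ 0ℚ

data Elimination {I : Set} {D : ℕ} (L : I → Fin D → ℚ) : Set where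
  basis       : (sel : Fin D → I) → Independent (L ∘ sel) → Elimination L
  annihilator : (α : Fin D → ℚ) → (∃ λ r → α r ≢ 0ℚ) →
                (∀ i → sumFin (λ r → α r * L i r) ≡ 0ℚ) → Elimination L

module EliminationStep {I : Set} {D : ℕ} (L : I → Fin (suc D) → ℚ)
                       (t₀ : I) (v : ℚ) (pivot : L t₀ zero * v ≡ 1ℚ) where
  open ≡-Reasoning

  scale : I → ℚ
  scale t = L t zero * v

  reduce : I → Fin D → ℚ
  reduce t r = L t (suc r) - scale t * L t₀ (suc r)

  scale-pivot : ∀ t → scale t * L t₀ zero ≡ L t zero
  scale-pivot t = begin
    L t zero * v * L t₀ zero     ≡⟨ ℚP.*-assoc (L t zero) v _ ⟩
    L t zero * (v * L t₀ zero)   ≡⟨ cong (L t zero *_) (trans (ℚP.*-comm v _) pivot) ⟩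
    L t zero * 1ℚ                ≡⟨ ℚP.*-identityʳ _ ⟩
    L t zero                     ∎

  extend : (Fin D → ℚ) → Fin (suc D) → ℚ
  extend α zero    = - (sumFin (λ r → α r * L t₀ (suc r)) * v)
  extend α (suc r) = α r

  annihilator-step : (α : Fin D → ℚ) → (∀ t → sumFin (λ r → α r * reduce t r) ≡ 0ℚ) →
    ∀ t → sumFin (λ r → extend α r * L t r) ≡ 0ℚ
  annihilator-step α kills t = begin
    - (S₀ * v) * L t zero + Sₜ                 ≡⟨ cong (- (S₀ * v) * L t zero +_) Sₜ≡ ⟩
    - (S₀ * v) * L t zero + scale t * S₀       ≡⟨ solve 3 (λ s w l → :- (s :* w) :* l :+ (l :* w) :* s := con 0ℚ) refl S₀ v (L t zero) ⟩
    0ℚ                                         ∎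
    where
    S₀ = sumFin (λ r → α r * L t₀ (suc r))
    Sₜ = sumFin (λ r → α r * L t (suc r))
    Sₜ≡ : Sₜ ≡ scale t * S₀
    Sₜ≡ = begin
      Sₜ
        ≡⟨ solve 2 (λ x y → x := (x :- y) :+ y) refl Sₜ (scale t * S₀) ⟩
      (Sₜ - scale t * S₀) + scale t * S₀
        ≡⟨ cong (λ z → (Sₜ - z) + scale t * S₀) (sumFin-*ˡ (scale t) (λ r → α r * L t₀ (suc r))) ⟨
      (Sₜ - sumFin (λ r → scale t * (α r * L t₀ (suc r)))) + scale t * S₀
        ≡⟨ cong (_+ scale t * S₀) (sumFin-sub (λ r → α r * L t (suc r)) (λ r → scale t * (α r * L t₀ (suc r)))) ⟨
      sumFin (λ r → α r * L t (suc r) - scale t * (α r * L t₀ (suc r))) + scale t * S₀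
        ≡⟨ cong (_+ scale t * S₀) (sumFin-cong λ r → factor (α r) (L t (suc r)) (scale t) (L t₀ (suc r))) ⟩
      sumFin (λ r → α r * reduce t r) + scale t * S₀
        ≡⟨ cong (_+ scale t * S₀) (kills t) ⟩
      0ℚ + scale t * S₀
        ≡⟨ ℚP.+-identityˡ _ ⟩
      scale t * S₀ ∎
      where
      factor : ∀ a x c y → a * x - c * (a * y) ≡ a * (x - c * y)
      factor = solve 4 (λ a x c y → a :* x :- c :* (a :* y) := a :* (x :- c :* y)) refl

  basis-step : (sel : Fin D → I) → Independent (reduce ∘ sel) → Independent (L ∘ (t₀ VF.∷ sel))
  basis-step sel independent μ combination = μ≡0
    where
    w = L t₀ zero
    μ′ : Fin D → ℚ
    μ′ = μ ∘ suc
    C = sumFin (λ s → μ′ s * scale (sel s))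
    K = μ zero + C
    K*w≡0 : K * w ≡ 0ℚ
    K*w≡0 = begin
      (μ zero + C) * w                                ≡⟨ ℚP.*-distribʳ-+ w (μ zero) C ⟩
      μ zero * w + C * w                              ≡⟨ cong (μ zero * w +_) (sumFin-*ʳ w (λ s → μ′ s * scale (sel s))) ⟨
      μ zero * w + sumFin (λ s → μ′ s * scale (sel s) * w)
        ≡⟨ cong (μ zero * w +_) (sumFin-cong λ s → trans (ℚP.*-assoc (μ′ s) _ w) (cong (μ′ s *_) (scale-pivot (sel s)))) ⟩
      μ zero * w + sumFin (λ s → μ′ s * L (sel s) zero) ≡⟨ combination zero ⟩
      0ℚ                                              ∎
    K≡0 : K ≡ 0ℚ
    K≡0 = begin
      K              ≡⟨ ℚP.*-identityʳ K ⟨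
      K * 1ℚ         ≡⟨ cong (K *_) pivot ⟨
      K * (w * v)    ≡⟨ ℚP.*-assoc K w v ⟨
      K * w * v      ≡⟨ cong (_* v) K*w≡0 ⟩
      0ℚ * v         ≡⟨ ℚP.*-zeroˡ v ⟩
      0ℚ             ∎
    reduced : ∀ r → sumFin (λ s → μ′ s * reduce (sel s) r) ≡ 0ℚ
    reduced r = begin
      sumFin (λ s → μ′ s * (Lˢ s - scale (sel s) * y))
        ≡⟨ sumFin-cong (λ s → solve 4 (λ m x c y → m :* (x :- c :* y) := m :* x :- m :* c :* y) refl (μ′ s) (Lˢ s) (scale (sel s)) y) ⟩
      sumFin (λ s → μ′ s * Lˢ s - μ′ s * scale (sel s) * y)
        ≡⟨ sumFin-sub (λ s → μ′ s * Lˢ s) (λ s → μ′ s * scale (sel s) * y) ⟩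
      sumFin (λ s → μ′ s * Lˢ s) - sumFin (λ s → μ′ s * scale (sel s) * y)
        ≡⟨ cong₂ _-_ rest (sumFin-*ʳ y (λ s → μ′ s * scale (sel s))) ⟩
      - (μ zero * y) - C * y
        ≡⟨ solve 3 (λ m c y → :- (m :* y) :- c :* y := :- ((m :+ c) :* y)) refl (μ zero) C y ⟩
      - (K * y)      ≡⟨ cong (λ k → - (k * y)) K≡0 ⟩
      - (0ℚ * y)     ≡⟨ cong -_ (ℚP.*-zeroˡ y) ⟩
      0ℚ             ∎
      where
      y = L t₀ (suc r)
      Lˢ : Fin D → ℚ
      Lˢ s = L (sel s) (suc r)
      rest : sumFin (λ s → μ′ s * Lˢ s) ≡ - (μ zero * y)
      rest = begin
        sumFin (λ s → μ′ s * Lˢ s)                                   ≡⟨ solve 2 (λ x y → x := (y :+ x) :- y) refl _ (μ zero * y) ⟩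
        (μ zero * y + sumFin (λ s → μ′ s * Lˢ s)) - μ zero * y       ≡⟨ cong (_- μ zero * y) (combination (suc r)) ⟩
        0ℚ - μ zero * y                                              ≡⟨ ℚP.+-identityˡ _ ⟩
        - (μ zero * y)                                               ∎
    μ′≡0 : ∀ s → μ′ s ≡ 0ℚ
    μ′≡0 = independent μ′ reduced
    μ≡0 : ∀ s → μ s ≡ 0ℚ
    μ≡0 (suc s) = μ′≡0 s
    μ≡0 zero    = begin
      μ zero       ≡⟨ solve 2 (λ m c → m := (m :+ c) :- c) refl (μ zero) C ⟩
      K - C        ≡⟨ cong₂ _-_ K≡0 (sumFin-zero (λ s → trans (cong (_* scale (sel s)) (μ′≡0 s)) (ℚP.*-zeroˡ (scale (sel s))))) ⟩
      0ℚ           ∎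

  lift-elimination : Elimination reduce → Elimination L
  lift-elimination (basis sel independent)      = basis (t₀ VF.∷ sel) (basis-step sel independent)
  lift-elimination (annihilator α (r , α≢0) kills) = annihilator (extend α) (suc r , α≢0) (annihilator-step α kills)

eliminate : ∀ D {I : Set} → Searchable I → (L : I → Fin D → ℚ) → Elimination L
eliminate zero    search L = basis (λ ()) (λ μ _ ())
eliminate (suc D) search L with search (λ t → L t zero ≢ 0ℚ) (λ t → ¬? (L t zero ℚP.≟ 0ℚ))
... | inj₂ first-column-zero = annihilator (δ zero) (zero , λ ()) kills
  where
  kills : ∀ t → sumFin (λ r → δ zero r * L t r) ≡ 0ℚ
  kills t = trans (sumFin-δ zero (L t)) (decidable-stable (L t zero ℚP.≟ 0ℚ) (first-column-zero t))
... | inj₁ (t₀ , w≢0) = lift-elimination (eliminate D search reduce)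
  where
  open EliminationStep L t₀ ((1/ L t₀ zero) {{ℚ.≢-nonZero w≢0}}) (ℚP.*-inverseʳ (L t₀ zero) {{ℚ.≢-nonZero w≢0}})

-- The columns of u are D vectors in ℚ^(D+1); a basis among them would need D + 1 distinct indices in Fin D.
¬independent-suc : ∀ D (u : Fin (suc D) → Fin D → ℚ) → ¬ Independent u
¬independent-suc D u independent with eliminate (suc D) searchable-Fin (λ r s → u s r)
... | annihilator α (r , α≢0) kills = α≢0 (independent α kills r)
... | basis sel sel-independent with FP.pigeonhole (ℕP.n<1+n D) sel
...   | i , j , i<j , sel-i≡sel-j = 1≢0 (trans (sym μi≡1) (sel-independent μ combination i))
  where
  μ : Fin (suc D) → ℚ
  μ s = δ i s - δ j s
  i≢j : i ≢ j
  i≢j i≡j = FP.<-irrefl i≡j i<j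
  1≢0 : 1ℚ ≢ 0ℚ
  1≢0 ()
  μi≡1 : μ i ≡ 1ℚ
  μi≡1 with i F.≟ i | i F.≟ j
  ... | yes _ | no _   = refl
  ... | no i≢i | _     = ⊥-elim (i≢i refl)
  ... | _ | yes i≡j    = ⊥-elim (i≢j i≡j)
  combination : ∀ r → sumFin (λ s → μ s * u r (sel s)) ≡ 0ℚ
  combination r = begin
    sumFin (λ s → (δ i s - δ j s) * g s)               ≡⟨ sumFin-cong (λ s → distrib (δ i s) (δ j s) (g s)) ⟩
    sumFin (λ s → δ i s * g s - δ j s * g s)           ≡⟨ sumFin-sub (λ s → δ i s * g s) (λ s → δ j s * g s) ⟩
    sumFin (λ s → δ i s * g s) - sumFin (λ s → δ j s * g s) ≡⟨ cong₂ _-_ (sumFin-δ i g) (sumFin-δ j g) ⟩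
    g i - g j                                          ≡⟨ cong (λ z → g i - u r z) sel-i≡sel-j ⟨
    g i - g i                                          ≡⟨ ℚP.+-inverseʳ (g i) ⟩
    0ℚ                                                 ∎
    where
    open ≡-Reasoning
    g : Fin (suc D) → ℚ
    g s = u r (sel s)
    distrib : ∀ x y z → (x - y) * z ≡ x * z - y * z
    distrib = solve 3 (λ x y z → (x :- y) :* z := x :* z :- y :* z) refl

*-cancelˡ-zero : ∀ κ w → κ ≢ 0ℚ → κ * w ≡ 0ℚ → w ≡ 0ℚ
*-cancelˡ-zero κ w κ≢0 κw≡0 = begin
  w                ≡⟨ ℚP.*-identityˡ w ⟨
  1ℚ * w           ≡⟨ cong (_* w) (ℚP.*-inverseˡ κ) ⟨
  κ⁻¹ * κ * w      ≡⟨ ℚP.*-assoc κ⁻¹ κ w ⟩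
  κ⁻¹ * (κ * w)    ≡⟨ cong (κ⁻¹ *_) κw≡0 ⟩
  κ⁻¹ * 0ℚ         ≡⟨ ℚP.*-zeroʳ κ⁻¹ ⟩
  0ℚ               ∎
  where
  open ≡-Reasoning
  instance _ = ℚ.≢-nonZero κ≢0
  κ⁻¹ = 1/ κ

-- Affine dimension read off from coordinates

_·_ : ∀ {D} → (Fin D → ℚ) → (Fin D → ℚ) → ℚ
α · u = sumFin (λ r → α r * u r)

¬⊆-HasDim : ∀ {n d} {S T : Point n → Set} → HasDim S d → HasDim T (suc d) → ¬ (∀ x → T x → S x)
¬⊆-HasDim (_ , upper) ((p , p∈T , independent) , _) T⊆S = upper p (λ t → T⊆S (p t) (p∈T t)) independent

_≟²_ : ∀ {n} (pq pq′ : Fin n × Fin n) → Dec (pq ≡ pq′)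
_≟²_ = ≡-dec F._≟_ F._≟_

Displacement : ℕ → Set
Displacement n = List (ℚ × (Fin n × Fin n))

displacement : ∀ {n} → Displacement n → Fin n × Fin n → ℚ
displacement []               pq = 0ℚ
displacement ((κ , pq′) ∷ ds) pq = κ * ι ⌊ pq ≟² pq′ ⌋ + displacement ds pq

module Coordinates {n D : ℕ} (c : Fin D → Fin n × Fin n) where

  coordinate : Point n → Fin D → ℚ
  coordinate x r = uncurry x (c r)

  lift : Point n → Fin (suc D) → ℚ
  lift x = 1ℚ VF.∷ coordinate x

  -- On S, an affine dependence of the chosen coordinates is one of all coordinates.
  Determines : (Point n → Set) → Set
  Determines S = ∀ {m} (μ : Fin m → ℚ) (p : Fin m → Point n) → (∀ t → S (p t)) → sumFin μ ≡ 0ℚ →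
    (∀ r → sumFin (λ t → μ t * coordinate (p t) r) ≡ 0ℚ) → ∀ i j → sumFin (λ t → μ t * p t i j) ≡ 0ℚ

  Spans : ∀ {I : Set} → (I → Point n) → Set
  Spans w = ∀ α → (∀ i → α · lift (w i) ≡ 0ℚ) → ∀ r → α r ≡ 0ℚ

  private
    sum-*1 : ∀ {m} (μ : Fin m → ℚ) → sumFin (λ t → μ t * 1ℚ) ≡ sumFin μ
    sum-*1 μ = sumFin-cong (λ t → ℚP.*-identityʳ (μ t))

  hasDim : ∀ {S : Point n → Set} {I : Set} → Determines S → Searchable I →
    (w : I → Point n) → (∀ i → S (w i)) → Spans w → HasDim S D
  hasDim {S} determines search w w∈S spans = lower (eliminate (suc D) search (lift ∘ w)) , upper
    where
    lower : Elimination (lift ∘ w) → Σ (Fin (suc D) → Point n) λ p → (∀ t → S (p t)) × AffinelyIndependent p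
    lower (annihilator α (r , α≢0) kills) = ⊥-elim (α≢0 (spans α kills r))
    lower (basis sel independent)         = w ∘ sel , w∈S ∘ sel , affine
      where
      affine : AffinelyIndependent (w ∘ sel)
      affine μ Σμ≡0 combination = independent μ λ where
        zero    → trans (sum-*1 μ) Σμ≡0
        (suc r) → combination (proj₁ (c r)) (proj₂ (c r))
    upper : ∀ p → (∀ t → S (p t)) → ¬ AffinelyIndependent p
    upper p p∈S affine = ¬independent-suc (suc D) (lift ∘ p) λ μ combination →
      let Σμ≡0 = trans (sym (sum-*1 μ)) (combination zero)
      in affine μ Σμ≡0 (determines μ p p∈S Σμ≡0 (combination ∘ suc))

  -- The entry of α at the coordinate pq, and 0 if pq is not a coordinate.
  weight : (Fin (suc D) → ℚ) → Fin n × Fin n → ℚ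
  weight α pq = sumFin (λ r → α (suc r) * ι ⌊ c r ≟² pq ⌋)

  weight-coordinate : Injective _≡_ _≡_ c → ∀ α r → weight α (c r) ≡ α (suc r)
  weight-coordinate c-injective α r = trans (sumFin-single _ r off) on
    where
    off : ∀ s → s ≢ r → α (suc s) * ι ⌊ c s ≟² c r ⌋ ≡ 0ℚ
    off s s≢r with c s ≟² c r
    ... | yes cs≡cr = ⊥-elim (s≢r (c-injective cs≡cr))
    ... | no _      = ℚP.*-zeroʳ (α (suc s))
    on : α (suc r) * ι ⌊ c r ≟² c r ⌋ ≡ α (suc r)
    on with c r ≟² c r
    ... | yes _     = ℚP.*-identityʳ (α (suc r))
    ... | no cr≢cr  = ⊥-elim (cr≢cr refl)

  weight-absent : ∀ α pq → (∀ r → c r ≢ pq) → weight α pq ≡ 0ℚ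
  weight-absent α pq absent = sumFin-zero off
    where
    off : ∀ r → α (suc r) * ι ⌊ c r ≟² pq ⌋ ≡ 0ℚ
    off r with c r ≟² pq
    ... | yes cr≡pq = ⊥-elim (absent r cr≡pq)
    ... | no _      = ℚP.*-zeroʳ (α (suc r))

  weighted : (Fin (suc D) → ℚ) → Displacement n → ℚ
  weighted α []              = 0ℚ
  weighted α ((κ , pq) ∷ ds) = κ * weight α pq + weighted α ds

  sumFin-displacement : ∀ α ds → sumFin (λ r → α (suc r) * displacement ds (c r)) ≡ weighted α ds
  sumFin-displacement α []               = sumFin-zero (λ r → ℚP.*-zeroʳ (α (suc r)))
  sumFin-displacement α ((κ , pq) ∷ ds) = begin
    sumFin (λ r → α (suc r) * (κ * e r + d r))
      ≡⟨ sumFin-cong (λ r → solve 4 (λ a k e d → a :* (k :* e :+ d) := k :* (a :* e) :+ a :* d) refl (α (suc r)) κ (e r) (d r)) ⟩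
    sumFin (λ r → κ * (α (suc r) * e r) + α (suc r) * d r)
      ≡⟨ sumFin-+ (λ r → κ * (α (suc r) * e r)) (λ r → α (suc r) * d r) ⟩
    sumFin (λ r → κ * (α (suc r) * e r)) + sumFin (λ r → α (suc r) * d r)
      ≡⟨ cong₂ _+_ (sumFin-*ˡ κ (λ r → α (suc r) * e r)) (sumFin-displacement α ds) ⟩
    κ * weight α pq + weighted α ds ∎
    where
    open ≡-Reasoning
    e d : Fin D → ℚ
    e r = ι ⌊ c r ≟² pq ⌋
    d r = displacement ds (c r)

  move : ∀ α x y ds → α · lift x ≡ 0ℚ → α · lift y ≡ 0ℚ →
    (∀ r → coordinate x r - coordinate y r ≡ displacement ds (c r)) → weighted α ds ≡ 0ℚ
  move α x y ds αx≡0 αy≡0 x-y = begin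
    weighted α ds
      ≡⟨ sumFin-displacement α ds ⟨
    sumFin (λ r → α (suc r) * displacement ds (c r))
      ≡⟨ sumFin-cong (λ r → cong (α (suc r) *_) (x-y r)) ⟨
    sumFin (λ r → α (suc r) * (coordinate x r - coordinate y r))
      ≡⟨ solve 2 (λ a z → z := a :* (con 1ℚ :- con 1ℚ) :+ z) refl (α zero) _ ⟩
    sumFin (λ R → α R * (lift x R - lift y R))
      ≡⟨ sumFin-cong (λ R → solve 3 (λ a u v → a :* (u :- v) := a :* u :- a :* v) refl (α R) (lift x R) (lift y R)) ⟩
    sumFin (λ R → α R * lift x R - α R * lift y R)
      ≡⟨ sumFin-sub (λ R → α R * lift x R) (λ R → α R * lift y R) ⟩
    α · lift x - α · lift y
      ≡⟨ cong₂ _-_ αx≡0 αy≡0 ⟩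
    0ℚ ∎
    where
    open ≡-Reasoning

  weighted-zero : ∀ α ds → All (λ d → weight α (proj₂ d) ≡ 0ℚ) ds → weighted α ds ≡ 0ℚ
  weighted-zero α []               []             = refl
  weighted-zero α ((κ , pq) ∷ ds) (w≡0 ∷ rest) = begin
    κ * weight α pq + weighted α ds ≡⟨ cong₂ (λ u v → κ * u + v) w≡0 (weighted-zero α ds rest) ⟩
    κ * 0ℚ + 0ℚ                     ≡⟨ solve 1 (λ k → k :* con 0ℚ :+ con 0ℚ := con 0ℚ) refl κ ⟩
    0ℚ                              ∎
    where open ≡-Reasoning

  weight-determined : ∀ α κ pq ds → κ ≢ 0ℚ → All (λ d → weight α (proj₂ d) ≡ 0ℚ) ds →
    weighted α ((κ , pq) ∷ ds) ≡ 0ℚ → weight α pq ≡ 0ℚ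
  weight-determined α κ pq ds κ≢0 rest-zero total≡0 = *-cancelˡ-zero κ (weight α pq) κ≢0 (begin
    κ * weight α pq                 ≡⟨ ℚP.+-identityʳ _ ⟨
    κ * weight α pq + 0ℚ            ≡⟨ cong (κ * weight α pq +_) (weighted-zero α ds rest-zero) ⟨
    weighted α ((κ , pq) ∷ ds)      ≡⟨ total≡0 ⟩
    0ℚ                              ∎)
    where open ≡-Reasoning

  spans-by-weights : Injective _≡_ _≡_ c → ∀ {I : Set} (w : I → Point n) → I →
    (∀ α → (∀ i → α · lift (w i) ≡ 0ℚ) → ∀ r → weight α (c r) ≡ 0ℚ) → Spans w
  spans-by-weights c-injective w i₀ vanish α kills (suc r) =
    trans (sym (weight-coordinate c-injective α r)) (vanish α kills r)
  spans-by-weights c-injective w i₀ vanish α kills zero = begin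
    α zero                                                     ≡⟨ solve 1 (λ a → a := a :* con 1ℚ :+ con 0ℚ) refl (α zero) ⟩
    α zero * 1ℚ + 0ℚ                                           ≡⟨ cong (α zero * 1ℚ +_) (sumFin-zero tail≡0) ⟨
    α zero * 1ℚ + sumFin (λ r → α (suc r) * coordinate (w i₀) r) ≡⟨ kills i₀ ⟩
    0ℚ                                                         ∎
    where
    open ≡-Reasoning
    tail≡0 : ∀ r → α (suc r) * coordinate (w i₀) r ≡ 0ℚ
    tail≡0 r = trans (cong (_* coordinate (w i₀) r) (spans-by-weights c-injective w i₀ vanish α kills (suc r)))
                     (ℚP.*-zeroˡ (coordinate (w i₀) r))

-- Off-diagonal pairs (i , j) are indexed by combine i (punchOut i≢j); removing the index of
-- (a , b) by punchIn leaves D = N(N-1) - 1 of them.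
module PairsExcept (m : ℕ) {a b : Fin (suc (suc m))} (a≢b : a ≢ b) where
  N D : ℕ
  N = suc (suc m)
  D = m ℕ.+ suc m ℕ.* suc m

  private
    index-ab : Fin (suc D)
    index-ab = F.combine a (F.punchOut a≢b)

    split : Fin D → Fin N × Fin (suc m)
    split r = F.remQuot (suc m) (F.punchIn index-ab r)

    remQuot-injective : ∀ (x y : Fin (N ℕ.* suc m)) → F.remQuot {N} (suc m) x ≡ F.remQuot (suc m) y → x ≡ y
    remQuot-injective x y eq =
      trans (sym (FP.combine-remQuot {N} (suc m) x)) (trans (cong (uncurry F.combine) eq) (FP.combine-remQuot {N} (suc m) y))

    punchIn-cong : ∀ {i i′ : Fin N} {k k′ : Fin (suc m)} → i ≡ i′ → F.punchIn i k ≡ F.punchIn i′ k′ → k ≡ k′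
    punchIn-cong {i} refl eq = FP.punchIn-injective i _ _ eq

  pair : Fin D → Fin N × Fin N
  pair r = proj₁ (split r) , F.punchIn (proj₁ (split r)) (proj₂ (split r))

  pair-offDiagonal : ∀ r → proj₁ (pair r) ≢ proj₂ (pair r)
  pair-offDiagonal r eq = FP.punchInᵢ≢i (proj₁ (split r)) (proj₂ (split r)) (sym eq)

  pair-injective : Injective _≡_ _≡_ pair
  pair-injective {r} {r′} eq = FP.punchIn-injective index-ab r r′ (remQuot-injective _ _ split≡)
    where
    split≡ : split r ≡ split r′
    split≡ = cong₂ _,_ (,-injectiveˡ eq) (punchIn-cong (,-injectiveˡ eq) (,-injectiveʳ eq))

  pair-≢ab : ∀ r → pair r ≢ (a , b)
  pair-≢ab r eq = FP.punchInᵢ≢i index-ab r (remQuot-injective _ _ split≡)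
    where
    split≡ : split r ≡ F.remQuot (suc m) index-ab
    split≡ = trans (cong₂ _,_ (,-injectiveˡ eq) (punchIn-cong (,-injectiveˡ eq) (trans (,-injectiveʳ eq) (sym (FP.punchIn-punchOut a≢b)))))
                   (sym (FP.remQuot-combine a _))

  pair-surjective : ∀ i j → i ≢ j → (i , j) ≢ (a , b) → ∃ λ r → pair r ≡ (i , j)
  pair-surjective i j i≢j ij≢ab = F.punchOut index≢ , pair≡
    where
    index : Fin (suc D)
    index = F.combine i (F.punchOut i≢j)
    index≢ : index-ab ≢ index
    index≢ eq with FP.combine-injective a _ i _ eq
    ... | refl , k≡ = ij≢ab (cong (a ,_) (trans (sym (FP.punchIn-punchOut i≢j))
                                         (trans (cong (F.punchIn a) (sym k≡)) (FP.punchIn-punchOut a≢b))))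
    split≡ : split (F.punchOut index≢) ≡ (i , F.punchOut i≢j)
    split≡ = trans (cong (F.remQuot (suc m)) (FP.punchIn-punchOut index≢)) (FP.remQuot-combine i _)
    pair≡ : pair (F.punchOut index≢) ≡ (i , j)
    pair≡ = trans (cong (λ s → proj₁ s , F.punchIn (proj₁ s) (proj₂ s)) split≡) (cong (i ,_) (FP.punchIn-punchOut i≢j))

fresh : ∀ {k N} → k ℕ.< N → (v : Vec (Fin N) k) → ∃ λ t → ∀ i → lookup v i ≢ t
fresh {k} {N} k<N v with FP.any? (λ t → FP.all? (λ i → ¬? (lookup v i F.≟ t)))
... | yes found = found
... | no none   = ⊥-elim (FP.<-irrefl collapse i<j)
  where
  hit : ∀ t → ∃ λ i → lookup v i ≡ t
  hit t with FP.any? (λ i → lookup v i F.≟ t)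
  ... | yes found = found
  ... | no missed = ⊥-elim (none (t , λ i eq → missed (i , eq)))
  clash = FP.pigeonhole k<N (proj₁ ∘ hit)
  i = proj₁ clash
  j = proj₁ (proj₂ clash)
  i<j = proj₁ (proj₂ (proj₂ clash))
  collapse : i ≡ j
  collapse = trans (sym (proj₂ (hit i))) (trans (cong (lookup v) (proj₂ (proj₂ (proj₂ clash)))) (proj₂ (hit j)))

charVec-offDiagonal : ∀ {n} (W : WeakOrder n) {p q} → p ≢ q → charVec W p q ≡ ι (WeakOrder.rel W p q)
charVec-offDiagonal W {p} {q} p≢q with p F.≟ q
... | yes p≡q = ⊥-elim (p≢q p≡q)
... | no _    = refl

charVec-diagonal : ∀ {n} (W : WeakOrder n) p → charVec W p p ≡ 0ℚ
charVec-diagonal W p with p F.≟ p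
... | yes _   = refl
... | no p≢p  = ⊥-elim (p≢p refl)

≤ᵇ-true : ∀ {m n} → m ℕ.≤ n → (m ℕ.≤ᵇ n) ≡ true
≤ᵇ-true m≤n = Equivalence.to T-≡ (ℕP.≤⇒≤ᵇ m≤n)

≤ᵇ-sound : ∀ {m n} → (m ℕ.≤ᵇ n) ≡ true → m ℕ.≤ n
≤ᵇ-sound {m} {n} m≤ᵇn = ℕP.≤ᵇ⇒≤ m n (Equivalence.from T-≡ m≤ᵇn)

≤ᵇ-false : ∀ {m n} → n ℕ.< m → (m ℕ.≤ᵇ n) ≡ false
≤ᵇ-false {m} {n} n<m with m ℕ.≤ᵇ n in m≤ᵇn
... | true  = ⊥-elim (ℕP.<⇒≱ n<m (≤ᵇ-sound m≤ᵇn))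
... | false = refl

ι-≤ᵇ-distinct : ∀ {m n} → m ≢ n → ι (m ℕ.≤ᵇ n) + ι (n ℕ.≤ᵇ m) ≡ 1ℚ
ι-≤ᵇ-distinct {m} {n} m≢n with ℕP.<-cmp m n
... | tri< m<n _ _ rewrite ≤ᵇ-true (ℕP.<⇒≤ m<n) | ≤ᵇ-false m<n = refl
... | tri≈ _ m≡n _ = ⊥-elim (m≢n m≡n)
... | tri> _ _ n<m rewrite ≤ᵇ-false n<m | ≤ᵇ-true (ℕP.<⇒≤ n<m) = refl

scoreOrder : ∀ {n} → (Fin n → ℕ) → WeakOrder n
scoreOrder s = record
  { rel   = λ i j → s j ℕ.≤ᵇ s i
  ; refl  = λ i → ≤ᵇ-true (ℕP.≤-refl {s i})
  ; trans = λ i j k j≤i k≤j → ≤ᵇ-true (ℕP.≤-trans (≤ᵇ-sound {s k} k≤j) (≤ᵇ-sound {s j} j≤i))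
  ; total = λ i j → Data.Sum.map ≤ᵇ-true ≤ᵇ-true (ℕP.≤-total (s j) (s i))
  }

Pivot : Set
Pivot = Fin 4

pattern A = zero
pattern B = suc zero
pattern J = suc (suc zero)
pattern K = suc (suc (suc zero))

Scores : Set
Scores = Pivot → Fin 10

scores : Fin 10 → Fin 10 → Fin 10 → Fin 10 → Scores
scores a b j k = lookup (a ∷ b ∷ j ∷ k ∷ [])

Label : Set
Label = Maybe Pivot

_≟ᴸ_ : (XY UV : Label × Label) → Dec (XY ≡ UV)
_≟ᴸ_ = ≡-dec (MaybeP.≡-dec F._≟_) (MaybeP.≡-dec F._≟_)

∀-Label? : {P : Label → Set} → (∀ X → Dec (P X)) → Dec (∀ X → P X)
∀-Label? P? = map′ (λ (at-nothing , at-just) → λ { nothing → at-nothing ; (just X) → at-just X }) (λ all → all nothing , all ∘ just)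
                   (P? nothing ×-dec FP.all? (P? ∘ just))

pivotRank : Scores → Pivot → Pivot → ℚ
pivotRank σ X Y = ι (toℕ (σ Y) ℕ.≤ᵇ toℕ (σ X))

labelDiff : Scores → Scores → Label → Label → ℚ
labelDiff σ σ′ (just X) (just Y) = pivotRank σ X Y - pivotRank σ′ X Y
labelDiff σ σ′ _        _        = 0ℚ

PivotDisplacement : Set
PivotDisplacement = List (ℚ × (Pivot × Pivot))

labelDisplacement : PivotDisplacement → Label → Label → ℚ
labelDisplacement []                   X Y = 0ℚ
labelDisplacement ((κ , U , V) ∷ ds) X Y = κ * ι ⌊ (X , Y) ≟ᴸ (just U , just V) ⌋ + labelDisplacement ds X Y

record Move (σ σ′ : Scores) (ds : PivotDisplacement) : Set where
  constructor mkMove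
  field
    labelDiff≡ : ∀ X Y → labelDiff σ σ′ X Y ≡ labelDisplacement ds X Y

move? : ∀ σ σ′ ds → Dec (Move σ σ′ ds)
move? σ σ′ ds = map′ mkMove Move.labelDiff≡ (∀-Label? λ X → ∀-Label? λ Y → labelDiff σ σ′ X Y ℚP.≟ labelDisplacement ds X Y)

ι-⇔ : ∀ {P Q : Set} → P ⇔ Q → (P? : Dec P) (Q? : Dec Q) → ι ⌊ P? ⌋ ≡ ι ⌊ Q? ⌋
ι-⇔ P⇔Q (yes _) (yes _) = refl
ι-⇔ P⇔Q (no _)  (no _)  = refl
ι-⇔ P⇔Q (yes p) (no ¬q) = ⊥-elim (¬q (Equivalence.to P⇔Q p))
ι-⇔ P⇔Q (no ¬p) (yes q) = ⊥-elim (¬p (Equivalence.from P⇔Q q))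

pivot<other : ∀ (σ : Scores) X t → toℕ (σ X) ℕ.< 10 ℕ.+ t
pivot<other σ X t = ℕP.<-≤-trans (FP.toℕ<n (σ X)) (ℕP.m≤m+n 10 t)

module PivotOrder {n : ℕ} (v : Vec (Fin n) 4) where

  label : Fin n → Label
  label p with FP.any? (λ X → p F.≟ lookup v X)
  ... | yes (X , _) = just X
  ... | no _        = nothing

  label-just : ∀ {p X} → label p ≡ just X → p ≡ lookup v X
  label-just {p} eq with FP.any? (λ X → p F.≟ lookup v X)
  label-just refl | yes (X , p≡vX) = p≡vX

  label-nothing : ∀ {p} → label p ≡ nothing → ∀ X → p ≢ lookup v X
  label-nothing {p} eq X p≡vX with FP.any? (λ X → p F.≟ lookup v X)
  label-nothing () X p≡vX | yes _
  label-nothing eq X p≡vX | no none = none (X , p≡vX)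

  label-lookup : Unique v → ∀ X → label (lookup v X) ≡ just X
  label-lookup unique X with label (lookup v X) in eq
  ... | nothing = ⊥-elim (label-nothing eq X refl)
  ... | just Y  = cong just (lookup-injective unique Y X (sym (label-just eq)))

  -- Pivots score below 10 and any other p scores 10 + p: the non-pivots lie above the pivots,
  -- strictly ordered among themselves.
  score : Scores → Fin n → ℕ
  score σ p = maybe (toℕ ∘ σ) (10 ℕ.+ toℕ p) (label p)

  order : Scores → WeakOrder n
  order σ = scoreOrder (score σ)

  point : Scores → Point n
  point σ = charVec (order σ)

  point-offDiagonal : ∀ σ {p q} → p ≢ q → point σ p q ≡ ι (score σ q ℕ.≤ᵇ score σ p)
  point-offDiagonal σ = charVec-offDiagonal (order σ)

  point-diff : ∀ σ σ′ {p q} → p ≢ q → point σ p q - point σ′ p q ≡ labelDiff σ σ′ (label p) (label q)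
  point-diff σ σ′ {p} {q} p≢q rewrite point-offDiagonal σ p≢q | point-offDiagonal σ′ p≢q
    with label p | label q
  ... | nothing | nothing = ℚP.+-inverseʳ (ι (10 ℕ.+ toℕ q ℕ.≤ᵇ 10 ℕ.+ toℕ p))
  ... | nothing | just Y
    rewrite ≤ᵇ-true (ℕP.<⇒≤ (pivot<other σ Y (toℕ p))) | ≤ᵇ-true (ℕP.<⇒≤ (pivot<other σ′ Y (toℕ p))) = refl
  ... | just X  | nothing
    rewrite ≤ᵇ-false (pivot<other σ X (toℕ q)) | ≤ᵇ-false (pivot<other σ′ X (toℕ q)) = refl
  ... | just X  | just Y  = refl

  label-other : ∀ {p} → (∀ X → p ≢ lookup v X) → label p ≡ nothing
  label-other {p} other with FP.any? (λ X → p F.≟ lookup v X)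
  ... | yes (X , p≡vX) = ⊥-elim (other X p≡vX)
  ... | no _           = refl

  point-pivots : ∀ σ {p q X Y} → label p ≡ just X → label q ≡ just Y → p ≢ q → point σ p q ≡ pivotRank σ X Y
  point-pivots σ {p} {q} lp lq p≢q rewrite point-offDiagonal σ p≢q | lp | lq = refl

  point-above : ∀ σ {p q Y} → label p ≡ nothing → label q ≡ just Y → p ≢ q → point σ p q ≡ 1ℚ
  point-above σ {p} {q} {Y} lp lq p≢q rewrite point-offDiagonal σ p≢q | lp | lq
    | ≤ᵇ-true (ℕP.<⇒≤ (pivot<other σ Y (toℕ p))) = refl

  point-below : ∀ σ {p q X} → label p ≡ just X → label q ≡ nothing → p ≢ q → point σ p q ≡ 0ℚ
  point-below σ {p} {q} {X} lp lq p≢q rewrite point-offDiagonal σ p≢q | lp | lq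
    | ≤ᵇ-false (pivot<other σ X (toℕ q)) = refl

  -- An element off the pivots has a score shared with nobody else, so exactly one of x_pq, x_qp is 1.
  point-strict : ∀ σ {p q} → p ≢ q → label p ≡ nothing ⊎ label q ≡ nothing → point σ p q + point σ q p ≡ 1ℚ
  point-strict σ {p} {q} p≢q other rewrite point-offDiagonal σ p≢q | point-offDiagonal σ (p≢q ∘ sym) =
    ι-≤ᵇ-distinct (scores-distinct p≢q other)
    where
    scores-distinct : ∀ {p q} → p ≢ q → label p ≡ nothing ⊎ label q ≡ nothing → score σ q ≢ score σ p
    scores-distinct {p} {q} p≢q other with label p | label q
    ... | nothing | nothing = λ eq → p≢q (sym (FP.toℕ-injective (ℕP.+-cancelˡ-≡ 10 _ _ eq)))
    ... | nothing | just Y  = ℕP.<⇒≢ (pivot<other σ Y (toℕ p))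
    ... | just X  | nothing = ℕP.<⇒≢ (pivot<other σ X (toℕ q)) ∘ sym
    scores-distinct p≢q (inj₁ ()) | just _ | just _
    scores-distinct p≢q (inj₂ ()) | just _ | just _

  pair-label : Unique v → ∀ p q U V →
    ι ⌊ (p , q) ≟² (lookup v U , lookup v V) ⌋ ≡ ι ⌊ (label p , label q) ≟ᴸ (just U , just V) ⌋
  pair-label unique p q U V = ι-⇔ (mk⇔ to from) _ _
    where
    to : (p , q) ≡ (lookup v U , lookup v V) → (label p , label q) ≡ (just U , just V)
    to refl = cong₂ _,_ (label-lookup unique U) (label-lookup unique V)
    from : (label p , label q) ≡ (just U , just V) → (p , q) ≡ (lookup v U , lookup v V)
    from eq = cong₂ _,_ (label-just (,-injectiveˡ eq)) (label-just (,-injectiveʳ eq))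

  onPairs : PivotDisplacement → Displacement n
  onPairs = Data.List.map λ (κ , U , V) → κ , lookup v U , lookup v V

  point-move : Unique v → ∀ {σ σ′ ds} → Move σ σ′ ds →
    ∀ {p q} → p ≢ q → point σ p q - point σ′ p q ≡ displacement (onPairs ds) (p , q)
  point-move unique {σ} {σ′} {ds} moves {p} {q} p≢q =
    trans (point-diff σ σ′ p≢q) (trans (Move.labelDiff≡ moves (label p) (label q)) (on-labels ds))
    where
    on-labels : ∀ ds → labelDisplacement ds (label p) (label q) ≡ displacement (onPairs ds) (p , q)
    on-labels []                   = refl
    on-labels ((κ , U , V) ∷ ds) = cong₂ (λ e d → κ * e + d) (sym (pair-label unique p q U V)) (on-labels ds)

-- The left-hand side as a constant plus slacks

module _ where
  open import Algebra.Properties.Semiring.Mult (CommutativeRing.semiring ℚP.+-*-commutativeRing)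
    using (×1-homo-*) renaming (_×_ to _·1_)

  fromℕ : ℕ → ℚ
  fromℕ k = k ·1 1ℚ

  fromℕ-* : ∀ m k → fromℕ (m ℕ.* k) ≡ fromℕ m * fromℕ k
  fromℕ-* = ×1-homo-*

sumFin-1 : ∀ k → sumFin {k} (λ _ → 1ℚ) ≡ fromℕ k
sumFin-1 zero    = refl
sumFin-1 (suc k) = cong (1ℚ +_) (sumFin-1 k)

module _ where
  open import Data.Integer.Solver renaming (module +-*-Solver to ℤ-Solver)
  open ℤ-Solver using () renaming (solve to solveℤ; _:+_ to _⊕_; _:*_ to _⊗_; _:=_ to _⊜_; con to κ)

  private
    toℚᵘ-fromℕ : ∀ k → ℚ.toℚᵘ (fromℕ k) ℚᵘ.≃ ℚᵘ.mkℚᵘ (ℤ.+ k) 0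
    toℚᵘ-fromℕ zero    = ℚᵘP.≃-refl
    toℚᵘ-fromℕ (suc k) = ℚᵘP.≃-trans (ℚP.toℚᵘ-homo-+ 1ℚ (fromℕ k))
      (ℚᵘP.≃-trans (ℚᵘP.+-congʳ ℚᵘ.1ℚᵘ (toℚᵘ-fromℕ k))
        (ℚᵘ.*≡* (solveℤ 1 (λ x → (one ⊗ one ⊕ x ⊗ one) ⊗ one ⊜ (one ⊕ x) ⊗ one) refl (ℤ.+ k))))
      where one = κ (ℤ.+ 1)

  -- rhs13 is written with normalising division; this converts it to ring operations.
  /2≡fromℕ*½ : ∀ k → ℤ.+ k / 2 ≡ fromℕ k * ½
  /2≡fromℕ*½ k = ℚP.toℚᵘ-injective (ℚᵘP.≃-trans (ℚP.toℚᵘ-fromℚᵘ (ℚᵘ.mkℚᵘ (ℤ.+ k) 1))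
    (ℚᵘP.≃-sym (ℚᵘP.≃-trans (ℚP.toℚᵘ-homo-* (fromℕ k) ½)
      (ℚᵘP.≃-trans (ℚᵘP.*-cong (toℚᵘ-fromℕ k) (ℚᵘP.≃-refl {ℚᵘ.mkℚᵘ (ℤ.+ 1) 1}))
        (ℚᵘ.*≡* (solveℤ 1 (λ x → (x ⊗ κ (ℤ.+ 1)) ⊗ κ (ℤ.+ 2) ⊜ x ⊗ κ (ℤ.+ 2)) refl (ℤ.+ k)))))))

2ℚ : ℚ
2ℚ = 1ℚ + 1ℚ

-- With m = n - 2 outsiders, rhs13 n = 2m - m(m-1)/2.
rhs13-outsiders : ∀ k → rhs13 (4 ℕ.+ k) ≡ 2ℚ * fromℕ (2 ℕ.+ k) - (fromℕ (2 ℕ.+ k) * fromℕ (2 ℕ.+ k) - fromℕ (2 ℕ.+ k)) * ½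
rhs13-outsiders zero    = refl
rhs13-outsiders (suc k) = begin
  ℤ.+ 3 / 1 - ℤ.+ (suc k ℕ.* k) / 2
    ≡⟨ cong (λ z → ℤ.+ 3 / 1 - z) (trans (/2≡fromℕ*½ (suc k ℕ.* k)) (cong (_* ½) (fromℕ-* (suc k) k))) ⟩
  ℤ.+ 3 / 1 - fromℕ (suc k) * fromℕ k * ½
    ≡⟨ solve 1 (λ x → con (ℤ.+ 3 / 1) :- (con 1ℚ :+ x) :* x :* con ½
                  := (con 1ℚ :+ con 1ℚ) :* M x :- (M x :* M x :- M x) :* con ½) refl (fromℕ k) ⟩
  2ℚ * fromℕ (3 ℕ.+ k) - (fromℕ (3 ℕ.+ k) * fromℕ (3 ℕ.+ k) - fromℕ (3 ℕ.+ k)) * ½ ∎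
  where
  open ≡-Reasoning
  M = λ x → con 1ℚ :+ (con 1ℚ :+ (con 1ℚ :+ x))

⌊≟⌋-sym : ∀ {n} (i j : Fin n) → ⌊ i F.≟ j ⌋ ≡ ⌊ j F.≟ i ⌋
⌊≟⌋-sym i j with i F.≟ j | j F.≟ i
... | yes _   | yes _   = refl
... | no _    | no _    = refl
... | yes i≡j | no j≢i  = ⊥-elim (j≢i (sym i≡j))
... | no i≢j  | yes j≡i = ⊥-elim (i≢j (sym j≡i))

distinct : ∀ {n} → (Fin n → Bool) → Fin n → Fin n → Bool
distinct s j j′ = s j ∧ s j′ ∧ not ⌊ j F.≟ j′ ⌋

distinct-sym : ∀ {n} (s : Fin n → Bool) j j′ → distinct s j j′ ≡ distinct s j′ j
distinct-sym s j j′ rewrite ⌊≟⌋-sym j j′ with s j | s j′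
... | true  | true  = refl
... | true  | false = refl
... | false | true  = refl
... | false | false = refl

distinct-≢ : ∀ {n} (s : Fin n → Bool) {j j′} → distinct s j j′ ≡ true → j ≢ j′
distinct-≢ s {j} {j′} d j≡j′ with j F.≟ j′
... | yes _    = ∧-false (s j) (s j′) d
  where
  ∧-false : ∀ p q → p ∧ q ∧ false ≢ true
  ∧-false true true ()
  ∧-false true false ()
  ∧-false false q ()
... | no j≢j′ = j≢j′ j≡j′

distinct-intro : ∀ {n} (s : Fin n → Bool) {j j′} → s j ≡ true → s j′ ≡ true → j ≢ j′ → distinct s j j′ ≡ true
distinct-intro s {j} {j′} sj sj′ j≢j′ rewrite sj | sj′ with j F.≟ j′
... | yes j≡j′ = ⊥-elim (j≢j′ j≡j′)
... | no _     = refl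

distinct-members : ∀ {n} (s : Fin n → Bool) {j j′} → distinct s j j′ ≡ true → s j ≡ true × s j′ ≡ true
distinct-members s {j} {j′} d with s j | s j′
... | true  | true  = refl , refl
distinct-members s () | true  | false
distinct-members s () | false | _

count-distinct : ∀ {n} (s : Fin n → Bool) → let #s = sumFin (ι ∘ s) in
  sumFin (λ j → sumFin (λ j′ → ι (distinct s j j′))) ≡ #s * #s - #s
count-distinct s = begin
  sumFin (λ j → sumFin (λ j′ → ι (distinct s j j′)))
    ≡⟨ sumFin-cong (λ j → sumFin-cong (by-products j)) ⟩
  sumFin (λ j → sumFin (λ j′ → ι (s j) * ι (s j′) - δ j j′ * ι (s j′)))
    ≡⟨ sumFin-cong (λ j → trans (sumFin-sub (λ j′ → ι (s j) * ι (s j′)) (λ j′ → δ j j′ * ι (s j′)))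
                                 (cong₂ _-_ (sumFin-*ˡ (ι (s j)) (ι ∘ s)) (sumFin-δ j (ι ∘ s)))) ⟩
  sumFin (λ j → ι (s j) * #s - ι (s j))
    ≡⟨ sumFin-sub (λ j → ι (s j) * #s) (ι ∘ s) ⟩
  sumFin (λ j → ι (s j) * #s) - #s
    ≡⟨ cong (_- #s) (sumFin-*ʳ #s (ι ∘ s)) ⟩
  #s * #s - #s ∎
  where
  open ≡-Reasoning
  #s = sumFin (ι ∘ s)
  by-products : ∀ j j′ → ι (distinct s j j′) ≡ ι (s j) * ι (s j′) - δ j j′ * ι (s j′)
  by-products j j′ with j F.≟ j′ | j′ F.≟ j
  ... | yes j≡j′ | no j′≢j  = ⊥-elim (j′≢j (sym j≡j′))
  ... | no j≢j′  | yes j′≡j = ⊥-elim (j≢j′ (sym j′≡j))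
  ... | yes refl | yes _ with s j
  ...   | true  = refl
  ...   | false = refl
  by-products j j′ | no _ | no _ with s j | s j′
  ...   | true  | true  = refl
  ...   | true  | false = refl
  ...   | false | true  = refl
  ...   | false | false = refl

module Slacks {n : ℕ} (a b : Fin n) where

  outsider : Fin n → Bool
  outsider = outside a b

  apart : Fin n → Fin n → Bool
  apart = distinct outsider

  outsider-≢ : ∀ {j} → outsider j ≡ true → a ≢ j × b ≢ j
  outsider-≢ {j} o with j F.≟ a | j F.≟ b
  outsider-≢ () | yes _ | _
  outsider-≢ () | no _  | yes _
  ... | no j≢a | no j≢b = j≢a ∘ sym , j≢b ∘ sym

  outsider-intro : ∀ {p} → p ≢ a → p ≢ b → outsider p ≡ true
  outsider-intro {p} p≢a p≢b with p F.≟ a | p F.≟ b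
  ... | yes p≡a | _       = ⊥-elim (p≢a p≡a)
  ... | no _    | yes p≡b = ⊥-elim (p≢b p≡b)
  ... | no _    | no _    = refl

  headSlack : Point n → Fin n → ℚ
  headSlack x j = if outsider j then x a j + x j a + x j b - 2ℚ else 0ℚ

  pairSlack : Point n → Fin n → Fin n → ℚ
  pairSlack x j j′ = if apart j j′ then x j j′ + x j′ j - 1ℚ else 0ℚ

  headSlacks pairSlacks : Point n → ℚ
  headSlacks x = sumFin (headSlack x)
  pairSlacks x = sumFin (λ j → sumFin (pairSlack x j))

  #outsiders : ℚ
  #outsiders = sumFin (ι ∘ outsider)

  headTerms pairTerms : Point n → ℚ
  headTerms x = sumFin (λ j → if outsider j then x a j + x j a + x j b else 0ℚ)
  pairTerms x = sumFin (λ j → sumFin (λ j′ → if apart j j′ then x j j′ else 0ℚ))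

  headTerms≡ : ∀ x → headTerms x ≡ 2ℚ * #outsiders + headSlacks x
  headTerms≡ x = trans (sumFin-cong split) (trans (sumFin-+ (λ j → 2ℚ * ι (outsider j)) (headSlack x))
                                               (cong (_+ headSlacks x) (sumFin-*ˡ 2ℚ (ι ∘ outsider))))
    where
    split : ∀ j → (if outsider j then x a j + x j a + x j b else 0ℚ) ≡ 2ℚ * ι (outsider j) + headSlack x j
    split j with outsider j
    ... | true  = solve 1 (λ s → s := (con 1ℚ :+ con 1ℚ) :* con 1ℚ :+ (s :- (con 1ℚ :+ con 1ℚ))) refl (x a j + x j a + x j b)
    ... | false = refl

  pairSlack-diagonal : ∀ x p → pairSlack x p p ≡ 0ℚ
  pairSlack-diagonal x p with apart p p in ap
  ... | false = refl
  ... | true  = ⊥-elim (distinct-≢ outsider {p} ap refl)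

  pairSlack-sym : ∀ x p q → pairSlack x p q ≡ pairSlack x q p
  pairSlack-sym x p q rewrite distinct-sym outsider p q with apart q p
  ... | true  = cong (_- 1ℚ) (ℚP.+-comm (x p q) (x q p))
  ... | false = refl

  pairTerms-twice : ∀ x → pairTerms x + pairTerms x ≡ sumFin (λ j → sumFin (λ j′ → ι (apart j j′))) + pairSlacks x
  pairTerms-twice x = begin
    pairTerms x + pairTerms x
      ≡⟨ cong (pairTerms x +_) (sumFin-comm G) ⟩
    pairTerms x + sumFin (λ j → sumFin (λ j′ → G j′ j))
      ≡⟨ sumFin-+ (λ j → sumFin (G j)) (λ j → sumFin (λ j′ → G j′ j)) ⟨
    sumFin (λ j → sumFin (G j) + sumFin (λ j′ → G j′ j))
      ≡⟨ sumFin-cong (λ j → sumFin-+ (G j) (λ j′ → G j′ j)) ⟨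
    sumFin (λ j → sumFin (λ j′ → G j j′ + G j′ j))
      ≡⟨ sumFin-cong (λ j → sumFin-cong (λ j′ → symmetrise j j′)) ⟩
    sumFin (λ j → sumFin (λ j′ → ι (apart j j′) + pairSlack x j j′))
      ≡⟨ sumFin-cong (λ j → sumFin-+ (λ j′ → ι (apart j j′)) (pairSlack x j)) ⟩
    sumFin (λ j → sumFin (λ j′ → ι (apart j j′)) + sumFin (pairSlack x j))
      ≡⟨ sumFin-+ (λ j → sumFin (λ j′ → ι (apart j j′))) (λ j → sumFin (pairSlack x j)) ⟩
    sumFin (λ j → sumFin (λ j′ → ι (apart j j′))) + pairSlacks x ∎
    where
    open ≡-Reasoning
    G : Fin n → Fin n → ℚ
    G j j′ = if apart j j′ then x j j′ else 0ℚ
    symmetrise : ∀ j j′ → G j j′ + G j′ j ≡ ι (apart j j′) + pairSlack x j j′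
    symmetrise j j′ rewrite distinct-sym outsider j′ j with apart j j′
    ... | true  = solve 2 (λ p q → p :+ q := con 1ℚ :+ (p :+ q :- con 1ℚ)) refl (x j j′) (x j′ j)
    ... | false = refl

  count-apart : sumFin (λ j → sumFin (λ j′ → ι (apart j j′))) ≡ #outsiders * #outsiders - #outsiders
  count-apart = count-distinct outsider

  count-outsiders : a ≢ b → #outsiders ≡ fromℕ n - 1ℚ - 1ℚ
  count-outsiders a≢b = begin
    sumFin (ι ∘ outsider)                       ≡⟨ sumFin-cong by-deltas ⟩
    sumFin (λ j → 1ℚ - δ a j - δ b j)           ≡⟨ sumFin-sub (λ j → 1ℚ - δ a j) (δ b) ⟩
    sumFin (λ j → 1ℚ - δ a j) - sumFin (δ b)    ≡⟨ cong₂ _-_ (sumFin-sub {n} (λ _ → 1ℚ) (δ a)) (sumFin-δ₁ b) ⟩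
    sumFin {n} (λ _ → 1ℚ) - sumFin (δ a) - 1ℚ   ≡⟨ cong₂ (λ u w → u - w - 1ℚ) (sumFin-1 n) (sumFin-δ₁ a) ⟩
    fromℕ n - 1ℚ - 1ℚ                           ∎
    where
    open ≡-Reasoning
    by-deltas : ∀ j → ι (outsider j) ≡ 1ℚ - δ a j - δ b j
    by-deltas j with j F.≟ a | j F.≟ b
    ... | yes j≡a | yes j≡b = ⊥-elim (a≢b (trans (sym j≡a) j≡b))
    ... | yes _   | no _    = refl
    ... | no _    | yes _   = refl
    ... | no _    | no _    = refl
    sumFin-δ₁ : ∀ i → sumFin (δ i) ≡ 1ℚ
    sumFin-δ₁ i = trans (sumFin-cong (λ s → sym (ℚP.*-identityʳ (δ i s)))) (sumFin-δ i (λ _ → 1ℚ))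

lhs13-slacks : ∀ k {a b : Fin (4 ℕ.+ k)} → a ≢ b → ∀ x →
  lhs13 a b x ≡ rhs13 (4 ℕ.+ k) + Slacks.headSlacks a b x - x a b - Slacks.pairSlacks a b x * ½
lhs13-slacks k {a} {b} a≢b x = begin
  headTerms x - x a b - pairTerms x
    ≡⟨ cong₂ (λ u w → u - x a b - w) (headTerms≡ x) pairTerms≡ ⟩
  2ℚ * #outsiders + headSlacks x - x a b - (#outsiders * #outsiders - #outsiders + pairSlacks x) * ½
    ≡⟨ cong (λ m → 2ℚ * m + headSlacks x - x a b - (m * m - m + pairSlacks x) * ½) m≡ ⟩
  2ℚ * M + headSlacks x - x a b - (M * M - M + pairSlacks x) * ½
    ≡⟨ solve 4 (λ m h y t → (con 1ℚ :+ con 1ℚ) :* m :+ h :- y :- (m :* m :- m :+ t) :* con ½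
                 := ((con 1ℚ :+ con 1ℚ) :* m :- (m :* m :- m) :* con ½) :+ h :- y :- t :* con ½) refl M (headSlacks x) (x a b) (pairSlacks x) ⟩
  (2ℚ * M - (M * M - M) * ½) + headSlacks x - x a b - pairSlacks x * ½
    ≡⟨ cong (λ r → r + headSlacks x - x a b - pairSlacks x * ½) (rhs13-outsiders k) ⟨
  rhs13 (4 ℕ.+ k) + headSlacks x - x a b - pairSlacks x * ½ ∎
  where
  open ≡-Reasoning
  open Slacks a b
  M = fromℕ (2 ℕ.+ k)
  m≡ : #outsiders ≡ M
  m≡ = trans (count-outsiders a≢b) (solve 1 (λ z → con 1ℚ :+ (con 1ℚ :+ z) :- con 1ℚ :- con 1ℚ := z) refl M)
  pairTerms≡ : pairTerms x ≡ (#outsiders * #outsiders - #outsiders + pairSlacks x) * ½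
  pairTerms≡ = begin
    pairTerms x                     ≡⟨ solve 1 (λ s → s := (s :+ s) :* con ½) refl (pairTerms x) ⟩
    (pairTerms x + pairTerms x) * ½     ≡⟨ cong (_* ½) (trans (pairTerms-twice x) (cong (_+ pairSlacks x) count-apart)) ⟩
    (#outsiders * #outsiders - #outsiders + pairSlacks x) * ½ ∎

-- Validity

∀-Bool? : {P : Bool → Set} → (∀ b → Dec (P b)) → Dec (∀ b → P b)
∀-Bool? P? = map′ (λ (t , f) → λ { true → t ; false → f }) (λ all → all true , all false) (P? true ×-dec P? false)

no-chain-slack : ∀ p q r → p ∧ r ≡ false → ι p + ι q + ι r - 2ℚ ≤ 0ℚ
no-chain-slack = from-yes (∀-Bool? λ p → ∀-Bool? λ q → ∀-Bool? λ r →
  (p ∧ r Data.Bool.≟ false) →-dec (ι p + ι q + ι r - 2ℚ ℚP.≤? 0ℚ))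

chain-slack : ∀ p q r → ι p + ι q + ι r - 2ℚ ≤ ι (p ∧ q)
chain-slack = from-yes (∀-Bool? λ p → ∀-Bool? λ q → ∀-Bool? λ r → ι p + ι q + ι r - 2ℚ ℚP.≤? ι (p ∧ q))

total-slack : ∀ p q u → p ∨ q ≡ true → (u ≡ true → p ∧ q ≡ true) → ι u ≤ ι p + ι q - 1ℚ
total-slack = from-yes (∀-Bool? λ p → ∀-Bool? λ q → ∀-Bool? λ u →
  (p ∨ q Data.Bool.≟ true) →-dec ((u Data.Bool.≟ true) →-dec (p ∧ q Data.Bool.≟ true)) →-dec (ι u ℚP.≤? ι p + ι q - 1ℚ))

≤-by-computation : ∀ p q → {True (p ℚP.≤? q)} → p ≤ q
≤-by-computation p q {p≤q} = toWitness p≤q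

sumFin-ι : ∀ {k} (s : Fin k → Bool) → ∃ λ c → sumFin (ι ∘ s) ≡ fromℕ c
sumFin-ι {zero}  s = 0 , refl
sumFin-ι {suc k} s with s zero | sumFin-ι (s ∘ suc)
... | true  | c , eq = suc c , cong (1ℚ +_) eq
... | false | c , eq = c , trans (ℚP.+-identityˡ _) eq

-- t - 1 - t(t-1)/2 = -(t-1)(t-2)/2
tie-count-bound : ∀ c → fromℕ c - 1ℚ - (fromℕ c * fromℕ c - fromℕ c) * ½ ≤ 0ℚ
tie-count-bound 0 = ≤-by-computation _ _
tie-count-bound 1 = ≤-by-computation _ _
tie-count-bound (suc (suc c)) = begin
  fromℕ (2 ℕ.+ c) - 1ℚ - (fromℕ (2 ℕ.+ c) * fromℕ (2 ℕ.+ c) - fromℕ (2 ℕ.+ c)) * ½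
    ≡⟨ solve 1 (λ y → (con 1ℚ :+ (con 1ℚ :+ y)) :- con 1ℚ
                      :- ((con 1ℚ :+ (con 1ℚ :+ y)) :* (con 1ℚ :+ (con 1ℚ :+ y)) :- (con 1ℚ :+ (con 1ℚ :+ y))) :* con ½
                      := :- (y :* (con 1ℚ :+ y) :* con ½)) refl (fromℕ c) ⟩
  - (fromℕ c * fromℕ (1 ℕ.+ c) * ½)
    ≤⟨ ℚP.neg-antimono-≤ (nonneg-* (nonneg-* (fromℕ-nonneg c) (fromℕ-nonneg (1 ℕ.+ c))) (≤-by-computation 0ℚ ½)) ⟩
  0ℚ ∎
  where
  open ℚP.≤-Reasoning
  nonneg-* : ∀ {p q} → 0ℚ ≤ p → 0ℚ ≤ q → 0ℚ ≤ p * q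
  nonneg-* {p} {q} 0≤p 0≤q = ℚP.nonNegative⁻¹ _ {{ℚP.nonNeg*nonNeg⇒nonNeg p {{ℚ.nonNegative 0≤p}} q {{ℚ.nonNegative 0≤q}}}}
  fromℕ-nonneg : ∀ k → 0ℚ ≤ fromℕ k
  fromℕ-nonneg zero    = ℚP.≤-refl
  fromℕ-nonneg (suc k) = ℚP.+-mono-≤ {0ℚ} {1ℚ} {0ℚ} (≤-by-computation 0ℚ 1ℚ) (fromℕ-nonneg k)

slack-mono : ∀ r {h h′} y {t t′} → h ≤ h′ → t′ ≤ t → r + h - y - t * ½ ≤ r + h′ - y - t′ * ½
slack-mono r y h≤h′ t′≤t =
  ℚP.+-mono-≤ (ℚP.+-monoˡ-≤ (- y) (ℚP.+-monoʳ-≤ r h≤h′)) (ℚP.neg-antimono-≤ (ℚP.*-monoʳ-≤-nonNeg ½ t′≤t))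

module Validity (k : ℕ) {a b : Fin (4 ℕ.+ k)} (a≢b : a ≢ b) (W : WeakOrder (4 ℕ.+ k)) where
  open Slacks a b
  open WeakOrder W using (rel)

  private
    x : Point (4 ℕ.+ k)
    x = charVec W

    rhs : ℚ
    rhs = rhs13 (4 ℕ.+ k)

    x-rel : ∀ {i j} → i ≢ j → x i j ≡ ι (rel i j)
    x-rel = charVec-offDiagonal W

    headSlack-rel : ∀ {j} → outsider j ≡ true → x a j + x j a + x j b - 2ℚ ≡ ι (rel a j) + ι (rel j a) + ι (rel j b) - 2ℚ
    headSlack-rel {j} o = cong (_- 2ℚ) (cong₂ _+_ (cong₂ _+_ (x-rel a≢j) (x-rel (a≢j ∘ sym))) (x-rel (b≢j ∘ sym)))
      where
      a≢j = proj₁ (outsider-≢ o)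
      b≢j = proj₂ (outsider-≢ o)

    trans-true : ∀ {i j l} → rel i j ∧ rel j l ≡ true → rel i l ≡ true
    trans-true {i} {j} {l} ij∧jl with rel i j in ij | rel j l in jl
    ... | true | true = WeakOrder.trans W i j l ij jl

    total-true : ∀ i j → rel i j ∨ rel j i ≡ true
    total-true i j with WeakOrder.total W i j
    ... | inj₁ ij rewrite ij = refl
    ... | inj₂ ji rewrite ji = Data.Bool.Properties.∨-zeroʳ (rel i j)

  tied : Fin (4 ℕ.+ k) → Bool
  tied j = outsider j ∧ (rel a j ∧ rel j a)

  headSlack≤0 : rel a b ≡ false → ∀ j → headSlack x j ≤ 0ℚ
  headSlack≤0 ab≡false j with outsider j in o
  ... | false = ℚP.≤-refl
  ... | true  = subst (_≤ 0ℚ) (sym (headSlack-rel o))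
                  (no-chain-slack (rel a j) (rel j a) (rel j b) (no-chain ab≡false))
    where
    no-chain : rel a b ≡ false → rel a j ∧ rel j b ≡ false
    no-chain ab≡false with rel a j ∧ rel j b in chain
    ... | true with () ← trans (sym (trans-true chain)) ab≡false
    ... | false = refl

  headSlack≤tied : ∀ j → headSlack x j ≤ ι (tied j)
  headSlack≤tied j with outsider j in o
  ... | false = ℚP.≤-refl
  ... | true  = subst (_≤ ι (rel a j ∧ rel j a)) (sym (headSlack-rel o)) (chain-slack (rel a j) (rel j a) (rel j b))

  pairSlack≥ : ∀ j j′ (u : Bool) → (u ≡ true → apart j j′ ≡ true × rel j j′ ∧ rel j′ j ≡ true) → ι u ≤ pairSlack x j j′
  pairSlack≥ j j′ u u⇒ with apart j j′ in ap
  ... | true  = subst (ι u ≤_) (sym pair-rel) (total-slack (rel j j′) (rel j′ j) u (total-true j j′) (proj₂ ∘ u⇒))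
    where
    j≢j′ : j ≢ j′
    j≢j′ = distinct-≢ outsider ap
    pair-rel : x j j′ + x j′ j - 1ℚ ≡ ι (rel j j′) + ι (rel j′ j) - 1ℚ
    pair-rel = cong (_- 1ℚ) (cong₂ _+_ (x-rel j≢j′) (x-rel (j≢j′ ∘ sym)))
  ... | false with u
  ...   | false = ℚP.≤-refl
  ...   | true with () ← proj₁ (u⇒ refl)

  tied-pair : ∀ j j′ → distinct tied j j′ ≡ true → apart j j′ ≡ true × rel j j′ ∧ rel j′ j ≡ true
  tied-pair j j′ t with outsider j in oj | outsider j′ in oj′ | rel a j in aj | rel j a in ja | rel a j′ in aj′ | rel j′ a in j′a
  ... | true | true | true | true | true | true =
    t , cong₂ _∧_ (WeakOrder.trans W j a j′ ja aj′) (WeakOrder.trans W j′ a j j′a aj)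

  valid-unordered : rel a b ≡ false → lhs13 a b x ≤ rhs
  valid-unordered ab = begin
    lhs13 a b x                                    ≡⟨ lhs13-slacks k a≢b x ⟩
    rhs + headSlacks x - x a b - pairSlacks x * ½  ≤⟨ slack-mono rhs (x a b) H≤0 0≤T ⟩
    rhs + 0ℚ - x a b - 0ℚ * ½                      ≡⟨ cong (λ y → rhs + 0ℚ - y - 0ℚ * ½) (trans (x-rel a≢b) (cong ι ab)) ⟩
    rhs + 0ℚ - 0ℚ - 0ℚ * ½                         ≡⟨ solve 1 (λ r → r :+ con 0ℚ :- con 0ℚ :- con 0ℚ :* con ½ := r) refl rhs ⟩
    rhs                                            ∎
    where
    open ℚP.≤-Reasoning
    H≤0 : headSlacks x ≤ 0ℚ
    H≤0 = subst (headSlacks x ≤_) (sumFin-zero {4 ℕ.+ k} (λ _ → refl))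
                (sumFin-mono (headSlack x) (λ _ → 0ℚ) (headSlack≤0 ab))
    0≤T : 0ℚ ≤ pairSlacks x
    0≤T = subst (_≤ pairSlacks x) (sumFin-zero {4 ℕ.+ k} (λ _ → sumFin-zero {4 ℕ.+ k} (λ _ → refl)))
                (sumFin-mono _ _ λ j → sumFin-mono _ _ λ j′ → pairSlack≥ j j′ false λ ())

  valid-ordered : rel a b ≡ true → lhs13 a b x ≤ rhs
  valid-ordered ab = begin
    lhs13 a b x                                    ≡⟨ lhs13-slacks k a≢b x ⟩
    rhs + headSlacks x - x a b - pairSlacks x * ½  ≤⟨ slack-mono rhs (x a b) H≤t T≥t²-t ⟩
    rhs + t - x a b - (t * t - t) * ½              ≡⟨ cong (λ y → rhs + t - y - (t * t - t) * ½) (trans (x-rel a≢b) (cong ι ab)) ⟩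
    rhs + t - 1ℚ - (t * t - t) * ½                 ≡⟨ regroup rhs t ⟩
    rhs + (t - 1ℚ - (t * t - t) * ½)               ≤⟨ ℚP.+-monoʳ-≤ rhs (subst (λ t → t - 1ℚ - (t * t - t) * ½ ≤ 0ℚ) (sym t≡) (tie-count-bound c)) ⟩
    rhs + 0ℚ                                       ≡⟨ ℚP.+-identityʳ rhs ⟩
    rhs                                            ∎
    where
    open ℚP.≤-Reasoning
    t = sumFin (ι ∘ tied)
    c = proj₁ (sumFin-ι tied)
    t≡ = proj₂ (sumFin-ι tied)
    regroup : ∀ r t → r + t - 1ℚ - (t * t - t) * ½ ≡ r + (t - 1ℚ - (t * t - t) * ½)
    regroup = solve 2 (λ r t → r :+ t :- con 1ℚ :- (t :* t :- t) :* con ½ := r :+ (t :- con 1ℚ :- (t :* t :- t) :* con ½)) refl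
    H≤t : headSlacks x ≤ t
    H≤t = sumFin-mono (headSlack x) (ι ∘ tied) headSlack≤tied
    T≥t²-t : t * t - t ≤ pairSlacks x
    T≥t²-t = subst (_≤ pairSlacks x) (count-distinct tied)
      (sumFin-mono _ _ λ j → sumFin-mono _ _ λ j′ → pairSlack≥ j j′ (distinct tied j j′) (tied-pair j j′))

  valid : lhs13 a b x ≤ rhs
  valid = by-order (rel a b) refl
    where
    by-order : ∀ v → rel a b ≡ v → lhs13 a b x ≤ rhs
    by-order false = valid-unordered
    by-order true  = valid-ordered

combination : ∀ {n m} → (Fin m → ℚ) → (Fin m → Point n) → Point n
combination μ p i j = sumFin (λ t → μ t * p t i j)

Linear : ∀ {n} → (Point n → ℚ) → Set
Linear {n} f = ∀ {m} (μ : Fin m → ℚ) (p : Fin m → Point n) x →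
  (∀ i j → x i j ≡ combination μ p i j) → f x ≡ sumFin (λ t → μ t * f (p t))

module _ {n : ℕ} where

  linear-coordinate : ∀ i j → Linear {n} (λ x → x i j)
  linear-coordinate i j μ p x x≡ = x≡ i j

  linear-+ : ∀ {f g : Point n → ℚ} → Linear f → Linear g → Linear (λ x → f x + g x)
  linear-+ {f} {g} lf lg μ p x x≡ = trans (cong₂ _+_ (lf μ p x x≡) (lg μ p x x≡))
    (trans (sym (sumFin-+ (λ t → μ t * f (p t)) (λ t → μ t * g (p t))))
           (sumFin-cong (λ t → sym (ℚP.*-distribˡ-+ (μ t) (f (p t)) (g (p t))))))

  linear-sub : ∀ {f g : Point n → ℚ} → Linear f → Linear g → Linear (λ x → f x - g x)
  linear-sub {f} {g} lf lg = linear-+ {f} {λ x → - g x} lf λ μ p x x≡ →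
    trans (cong -_ (lg μ p x x≡)) (trans (sym (sumFin-neg (λ t → μ t * g (p t))))
                                         (sumFin-cong (λ t → ℚP.neg-distribʳ-* (μ t) (g (p t)))))

  linear-if : ∀ (c : Bool) {f : Point n → ℚ} → Linear f → Linear (λ x → if c then f x else 0ℚ)
  linear-if true  lf         = lf
  linear-if false lf μ p x _ = sym (sumFin-zero (λ t → ℚP.*-zeroʳ (μ t)))

  linear-sum : ∀ {k} {F : Fin k → Point n → ℚ} → (∀ j → Linear (F j)) → Linear (λ x → sumFin (λ j → F j x))
  linear-sum {F = F} lF μ p x x≡ = begin
    sumFin (λ j → F j x)                              ≡⟨ sumFin-cong (λ j → lF j μ p x x≡) ⟩
    sumFin (λ j → sumFin (λ t → μ t * F j (p t)))     ≡⟨ sumFin-comm (λ j t → μ t * F j (p t)) ⟩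
    sumFin (λ t → sumFin (λ j → μ t * F j (p t)))     ≡⟨ sumFin-cong (λ t → sumFin-*ˡ (μ t) (λ j → F j (p t))) ⟩
    sumFin (λ t → μ t * sumFin (λ j → F j (p t)))     ∎
    where open ≡-Reasoning

  lhs13-linear : ∀ (a b : Fin n) → Linear (lhs13 a b)
  lhs13-linear a b =
    linear-sub (linear-sub (linear-sum λ j → linear-if (outside a b j)
                          (linear-+ (linear-+ (linear-coordinate a j) (linear-coordinate j a)) (linear-coordinate j b)))
                       (linear-coordinate a b))
             (linear-sum λ j → linear-sum λ j′ → linear-if (distinct (outside a b) j j′) (linear-coordinate j j′))

InPWO-charVec : ∀ {n} (W : WeakOrder n) → InPWO n (charVec W)
InPWO-charVec W = 1 , (λ _ → 1ℚ) , (λ _ → W) , (λ _ → ≤-by-computation 0ℚ 1ℚ) , refl ,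
  λ i j → sym (trans (ℚP.+-identityʳ _) (ℚP.*-identityˡ _))

InPWO-diagonal : ∀ {n x} → InPWO n x → ∀ i → x i i ≡ 0ℚ
InPWO-diagonal (k , λ′ , W , _ , _ , x≡) i =
  trans (x≡ i i) (sumFin-zero (λ t → trans (cong (λ′ t *_) (charVec-diagonal (W t) i)) (ℚP.*-zeroʳ (λ′ t))))

lhs13-valid : ∀ k {a b : Fin (4 ℕ.+ k)} → a ≢ b → ∀ x → InPWO (4 ℕ.+ k) x → lhs13 a b x ≤ rhs13 (4 ℕ.+ k)
lhs13-valid k {a} {b} a≢b x (m , λ′ , W , λ′≥0 , Σλ′≡1 , x≡) = begin
  lhs13 a b x                                      ≡⟨ lhs13-linear a b λ′ (charVec ∘ W) x x≡ ⟩
  sumFin (λ t → λ′ t * lhs13 a b (charVec (W t)))  ≤⟨ sumFin-mono _ _ weighted-valid ⟩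
  sumFin (λ t → λ′ t * rhs)                        ≡⟨ sumFin-*ʳ rhs λ′ ⟩
  sumFin λ′ * rhs                                  ≡⟨ cong (_* rhs) Σλ′≡1 ⟩
  1ℚ * rhs                                         ≡⟨ ℚP.*-identityˡ rhs ⟩
  rhs                                              ∎
  where
  open ℚP.≤-Reasoning
  rhs = rhs13 (4 ℕ.+ k)
  weighted-valid : ∀ t → λ′ t * lhs13 a b (charVec (W t)) ≤ λ′ t * rhs
  weighted-valid t = ℚP.*-monoˡ-≤-nonNeg (λ′ t) {{ℚ.nonNegative (λ′≥0 t)}} (Validity.valid k a≢b (W t))

pivotHeadSlack : Scores → Pivot → ℚ
pivotHeadSlack σ X = pivotRank σ A X + pivotRank σ X A + pivotRank σ X B - 2ℚ

pivotPairSlack : Scores → ℚ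
pivotPairSlack σ = pivotRank σ J K + pivotRank σ K J - 1ℚ

-- lhs13 - rhs13 at a pivot order: every slack involving a non-pivot vanishes.
Tight : Scores → Set
Tight σ = pivotHeadSlack σ J + pivotHeadSlack σ K - pivotRank σ A B - (pivotPairSlack σ + pivotPairSlack σ) * ½ ≡ 0ℚ

tight? : ∀ σ → Dec (Tight σ)
tight? σ = pivotHeadSlack σ J + pivotHeadSlack σ K - pivotRank σ A B - (pivotPairSlack σ + pivotPairSlack σ) * ½ ℚP.≟ 0ℚ

module Tightness (m : ℕ) {a b j k : Fin (4 ℕ.+ m)} (unique : Unique (a ∷ b ∷ j ∷ k ∷ [])) where
  open PivotOrder (a ∷ b ∷ j ∷ k ∷ [])
  open Slacks a b

  private
    pivots-≢ : ∀ {X Y} → X ≢ Y → lookup (a ∷ b ∷ j ∷ k ∷ []) X ≢ lookup (a ∷ b ∷ j ∷ k ∷ []) Y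
    pivots-≢ {X} {Y} X≢Y eq = X≢Y (lookup-injective unique X Y eq)

    label-a : label a ≡ just A
    label-a = label-lookup unique A
    label-b : label b ≡ just B
    label-b = label-lookup unique B
    label-j : label j ≡ just J
    label-j = label-lookup unique J
    label-k : label k ≡ just K
    label-k = label-lookup unique K

    label-outsider : ∀ {p} → outsider p ≡ true → p ≢ j → p ≢ k → label p ≡ nothing
    label-outsider o p≢j p≢k = label-other λ where
      A → proj₁ (outsider-≢ o) ∘ sym
      B → proj₂ (outsider-≢ o) ∘ sym
      J → p≢j
      K → p≢k

  headSlacks-point : ∀ σ → headSlacks (point σ) ≡ pivotHeadSlack σ J + pivotHeadSlack σ K
  headSlacks-point σ = trans (sumFin-pair (headSlack x) (pivots-≢ {J} {K} λ ()) other)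
                             (cong₂ _+_ (at label-j (pivots-≢ {A} {J} λ ()) (pivots-≢ {B} {J} λ ()))
                                        (at label-k (pivots-≢ {A} {K} λ ()) (pivots-≢ {B} {K} λ ())))
    where
    x = point σ
    at : ∀ {p X} → label p ≡ just X → a ≢ p → b ≢ p → headSlack x p ≡ pivotHeadSlack σ X
    at {p} lp a≢p b≢p rewrite outsider-intro (a≢p ∘ sym) (b≢p ∘ sym) =
      cong (_- 2ℚ) (cong₂ _+_ (cong₂ _+_ (point-pivots σ label-a lp a≢p) (point-pivots σ lp label-a (a≢p ∘ sym)))
                              (point-pivots σ lp label-b (b≢p ∘ sym)))
    other : ∀ p → p ≢ j → p ≢ k → headSlack x p ≡ 0ℚ
    other p p≢j p≢k with outsider p in o
    ... | false = refl
    ... | true  = cong (_- 2ℚ) (cong₂ _+_ (cong₂ _+_ (point-below σ label-a lp (proj₁ (outsider-≢ o)))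
                                                     (point-above σ lp label-a (proj₁ (outsider-≢ o) ∘ sym)))
                                          (point-above σ lp label-b (proj₂ (outsider-≢ o) ∘ sym)))
      where
      lp = label-outsider o p≢j p≢k

  pairSlacks-point : ∀ σ → pairSlacks (point σ) ≡ pivotPairSlack σ + pivotPairSlack σ
  pairSlacks-point σ = trans (sumFin-pair (λ p → sumFin (pairSlack x p)) j≢k row-other)
                             (cong₂ _+_ (trans (row j k j≢k (λ r≢j r≢k → r≢j , r≢k)) at-jk)
                                        (trans (row k j (j≢k ∘ sym) (λ r≢k r≢j → r≢j , r≢k)) (trans (pairSlack-sym x k j) at-jk)))
    where
    x = point σ
    j≢k = pivots-≢ {J} {K} λ ()
    vanishes : ∀ p q → (p ≢ j × p ≢ k) ⊎ (q ≢ j × q ≢ k) → pairSlack x p q ≡ 0ℚ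
    vanishes p q off with apart p q in ap
    ... | false = refl
    ... | true  = trans (cong (_- 1ℚ) (point-strict σ (distinct-≢ outsider ap) off-label)) (ℚP.+-inverseʳ 1ℚ)
      where
      off-label : label p ≡ nothing ⊎ label q ≡ nothing
      off-label = Data.Sum.map (λ (≢j , ≢k) → label-outsider (proj₁ (distinct-members outsider {p} {q} ap)) ≢j ≢k)
                               (λ (≢j , ≢k) → label-outsider (proj₂ (distinct-members outsider {p} {q} ap)) ≢j ≢k) off
    row-other : ∀ p → p ≢ j → p ≢ k → sumFin (pairSlack x p) ≡ 0ℚ
    row-other p p≢j p≢k = sumFin-zero λ q → vanishes p q (inj₁ (p≢j , p≢k))
    row : ∀ p q → p ≢ q → (∀ {r} → r ≢ p → r ≢ q → r ≢ j × r ≢ k) → sumFin (pairSlack x p) ≡ pairSlack x p q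
    row p q p≢q off = sumFin-single (pairSlack x p) q off-q
      where
      off-q : ∀ r → r ≢ q → pairSlack x p r ≡ 0ℚ
      off-q r r≢q = by-cases (r F.≟ p)
        where
        by-cases : Dec (r ≡ p) → pairSlack x p r ≡ 0ℚ
        by-cases (yes refl) = pairSlack-diagonal x r
        by-cases (no r≢p)   = vanishes p r (inj₂ (off r≢p r≢q))
    at-jk : pairSlack x j k ≡ pivotPairSlack σ
    at-jk rewrite distinct-intro outsider (outsider-intro (pivots-≢ {J} {A} λ ()) (pivots-≢ {J} {B} λ ()))
                                          (outsider-intro (pivots-≢ {K} {A} λ ()) (pivots-≢ {K} {B} λ ())) j≢k =
      cong (_- 1ℚ) (cong₂ _+_ (point-pivots σ label-j label-k j≢k) (point-pivots σ label-k label-j (j≢k ∘ sym)))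

  tight : ∀ σ → Tight σ → lhs13 a b (point σ) ≡ rhs13 (4 ℕ.+ m)
  tight σ tight-σ = begin
    lhs13 a b (point σ)
      ≡⟨ lhs13-slacks m (pivots-≢ {A} {B} λ ()) (point σ) ⟩
    rhs13 (4 ℕ.+ m) + headSlacks (point σ) - point σ a b - pairSlacks (point σ) * ½
      ≡⟨ cong₂ (λ h t → rhs13 (4 ℕ.+ m) + h - point σ a b - t * ½) (headSlacks-point σ) (pairSlacks-point σ) ⟩
    rhs13 (4 ℕ.+ m) + (hJ + hK) - point σ a b - (pp + pp) * ½
      ≡⟨ cong (λ y → rhs13 (4 ℕ.+ m) + (hJ + hK) - y - (pp + pp) * ½) (point-pivots σ label-a label-b (pivots-≢ {A} {B} λ ())) ⟩
    rhs13 (4 ℕ.+ m) + (hJ + hK) - pivotRank σ A B - (pp + pp) * ½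
      ≡⟨ solve 4 (λ r h y t → r :+ h :- y :- t := r :+ (h :- y :- t)) refl (rhs13 (4 ℕ.+ m)) (hJ + hK) (pivotRank σ A B) ((pp + pp) * ½) ⟩
    rhs13 (4 ℕ.+ m) + (hJ + hK - pivotRank σ A B - (pp + pp) * ½)
      ≡⟨ cong (rhs13 (4 ℕ.+ m) +_) tight-σ ⟩
    rhs13 (4 ℕ.+ m) + 0ℚ
      ≡⟨ ℚP.+-identityʳ _ ⟩
    rhs13 (4 ℕ.+ m) ∎
    where
    open ≡-Reasoning
    hJ = pivotHeadSlack σ J
    hK = pivotHeadSlack σ K
    pp = pivotPairSlack σ

lhs13-at-ab : ∀ {n} {a b : Fin n} (u : Point n) → (∀ i j → (i , j) ≢ (a , b) → u i j ≡ 0ℚ) → lhs13 a b u ≡ - u a b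
lhs13-at-ab {n} {a} {b} u u≡0 = begin
  headTerms u - u a b - pairTerms u   ≡⟨ cong₂ (λ h p → h - u a b - p) (sumFin-zero head≡0) (sumFin-zero λ j → sumFin-zero (pair≡0 j)) ⟩
  0ℚ - u a b - 0ℚ                     ≡⟨ solve 1 (λ y → con 0ℚ :- y :- con 0ℚ := :- y) refl (u a b) ⟩
  - u a b                             ∎
  where
  open ≡-Reasoning
  open Slacks a b
  head≡0 : ∀ j → (if outsider j then u a j + u j a + u j b else 0ℚ) ≡ 0ℚ
  head≡0 j with outsider j in o
  ... | false = refl
  ... | true  = trans (cong₂ _+_ (cong₂ _+_ (u≡0 a j (proj₂ (outsider-≢ o) ∘ sym ∘ ,-injectiveʳ))
                                            (u≡0 j a (proj₁ (outsider-≢ o) ∘ sym ∘ ,-injectiveˡ)))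
                                 (u≡0 j b (proj₁ (outsider-≢ o) ∘ sym ∘ ,-injectiveˡ)))
                      (ℚP.+-identityʳ (0ℚ + 0ℚ))
  pair≡0 : ∀ j j′ → (if apart j j′ then u j j′ else 0ℚ) ≡ 0ℚ
  pair≡0 j j′ with apart j j′ in ap
  ... | false = refl
  ... | true  = u≡0 j j′ (proj₁ (outsider-≢ (proj₁ (distinct-members outsider {j} {j′} ap))) ∘ sym ∘ ,-injectiveˡ)

module _ {n D : ℕ} (c : Fin D → Fin n × Fin n) (c-offDiagonal : ∀ r → proj₁ (c r) ≢ proj₂ (c r)) where
  open Coordinates c

  pivot-rule : ∀ {v : Vec (Fin n) 4} → Unique v →
    ∀ {σ σ′ κ U V ds} → Move σ σ′ ((κ , U , V) ∷ ds) → κ ≢ 0ℚ →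
    ∀ α → α · lift (PivotOrder.point v σ) ≡ 0ℚ → α · lift (PivotOrder.point v σ′) ≡ 0ℚ →
    All (λ d → weight α (proj₂ d) ≡ 0ℚ) (PivotOrder.onPairs v ds) → weight α (lookup v U , lookup v V) ≡ 0ℚ
  pivot-rule {v} unique {σ} {σ′} {κ} {U} {V} {ds} moves κ≢0 α kills-σ kills-σ′ rest =
    weight-determined α κ _ (onPairs ds) κ≢0 rest
      (move α (point σ) (point σ′) (onPairs ((κ , U , V) ∷ ds)) kills-σ kills-σ′ (λ r → point-move unique moves (c-offDiagonal r)))
    where open PivotOrder v

σ₁ σ₂ σ₃ σ₄ σ₅ σ₆ σ₇ σ₈ : Scores
σ₁ = scores (F.# 1) (F.# 2) (F.# 2) (F.# 6)
σ₂ = scores (F.# 1) (F.# 2) (F.# 3) (F.# 6)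
σ₃ = scores (F.# 1) (F.# 1) (F.# 1) (F.# 6)
σ₄ = scores (F.# 2) (F.# 1) (F.# 2) (F.# 6)
σ₅ = scores (F.# 1) (F.# 2) (F.# 1) (F.# 6)
σ₆ = scores (F.# 2) (F.# 1) (F.# 3) (F.# 2)
σ₇ = scores (F.# 3) (F.# 1) (F.# 3) (F.# 2)
σ₈ = scores (F.# 2) (F.# 1) (F.# 2) (F.# 2)

faceScores : Vec Scores 8
faceScores = σ₁ ∷ σ₂ ∷ σ₃ ∷ σ₄ ∷ σ₅ ∷ σ₆ ∷ σ₇ ∷ σ₈ ∷ []

faceScores-tight : ∀ o → Tight (lookup faceScores o)
faceScores-tight = from-yes (FP.all? (tight? ∘ lookup faceScores))

move-bj : Move σ₁ σ₂ ((1ℚ , B , J) ∷ [])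
move-bj = from-yes (move? σ₁ σ₂ ((1ℚ , B , J) ∷ []))

move-aj : Move σ₃ σ₁ ((1ℚ , A , J) ∷ (1ℚ , A , B) ∷ [])
move-aj = from-yes (move? σ₃ σ₁ ((1ℚ , A , J) ∷ (1ℚ , A , B) ∷ []))

move-ba : Move σ₃ σ₄ ((1ℚ , B , A) ∷ (1ℚ , B , J) ∷ [])
move-ba = from-yes (move? σ₃ σ₄ ((1ℚ , B , A) ∷ (1ℚ , B , J) ∷ []))

move-jb : Move σ₁ σ₅ ((1ℚ , J , B) ∷ (- 1ℚ , A , J) ∷ [])
move-jb = from-yes (move? σ₁ σ₅ ((1ℚ , J , B) ∷ (- 1ℚ , A , J) ∷ []))

move-ka : Move σ₆ σ₇ ((1ℚ , K , A) ∷ (- 1ℚ , A , J) ∷ [])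
move-ka = from-yes (move? σ₆ σ₇ ((1ℚ , K , A) ∷ (- 1ℚ , A , J) ∷ []))

move-kj : Move σ₆ σ₈ ((- 1ℚ , K , J) ∷ (- 1ℚ , A , J) ∷ [])
move-kj = from-yes (move? σ₆ σ₈ ((- 1ℚ , K , J) ∷ (- 1ℚ , A , J) ∷ []))

σ-ab σ-ba : Scores
σ-ab = scores (F.# 2) (F.# 2) (F.# 1) (F.# 1)
σ-ba = scores (F.# 2) (F.# 3) (F.# 1) (F.# 1)

move-ab : Move σ-ab σ-ba ((1ℚ , A , B) ∷ [])
move-ab = from-yes (move? σ-ab σ-ba ((1ℚ , A , B) ∷ []))

-- The dimensions of the polytope and of the face

unique4 : ∀ {n} {a b j k : Fin n} → a ≢ b → a ≢ j → a ≢ k → b ≢ j → b ≢ k → j ≢ k → Unique (a ∷ b ∷ j ∷ k ∷ [])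
unique4 a≢b a≢j a≢k b≢j b≢k j≢k =
  (a≢b VecAll.∷ a≢j VecAll.∷ a≢k VecAll.∷ VecAll.[]) ∷ (b≢j VecAll.∷ b≢k VecAll.∷ VecAll.[]) ∷ (j≢k VecAll.∷ VecAll.[]) ∷ VecAll.[] ∷ []

module Dimensions (m : ℕ) {a b : Fin (4 ℕ.+ m)} (a≢b : a ≢ b) where
  open PairsExcept (2 ℕ.+ m) a≢b

  Completes : Fin N → Fin N → Set
  Completes j k = Unique (a ∷ b ∷ j ∷ k ∷ [])

  completes? : ∀ j k → Dec (Completes j k)
  completes? j k = allPairs? (λ x y → ¬? (x F.≟ y)) (a ∷ b ∷ j ∷ k ∷ [])

  private
    3<N : 3 ℕ.< N
    3<N = ℕP.m≤m+n 4 m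

  complete-right : ∀ {j} → a ≢ j → b ≢ j → ∃ λ k → Completes j k
  complete-right {j} a≢j b≢j with fresh 3<N (a ∷ b ∷ j ∷ [])
  ... | k , new = k , unique4 a≢b a≢j (new A) b≢j (new B) (new J)

  complete-left : ∀ {k} → a ≢ k → b ≢ k → ∃ λ j → Completes j k
  complete-left {k} a≢k b≢k with fresh 3<N (a ∷ b ∷ k ∷ [])
  ... | j , new = j , unique4 a≢b (new A) a≢k (new B) b≢k (new J ∘ sym)

  some-completion : ∃₂ Completes
  some-completion with fresh (ℕP.m≤m+n 3 (suc m)) (a ∷ b ∷ [])
  ... | j , new = j , complete-right (new A) (new B)

  combination-off-ab : ∀ {m′} (μ : Fin m′ → ℚ) (p : Fin m′ → Point N) → (∀ t → InPWO N (p t)) →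
    (∀ r → combination μ p (proj₁ (pair r)) (proj₂ (pair r)) ≡ 0ℚ) → ∀ i j → (i , j) ≢ (a , b) → combination μ p i j ≡ 0ℚ
  combination-off-ab μ p p∈P coordinates i j ij≢ab with i F.≟ j
  ... | yes refl = sumFin-zero (λ t → trans (cong (μ t *_) (InPWO-diagonal (p∈P t) i)) (ℚP.*-zeroʳ (μ t)))
  ... | no i≢j   = subst (λ (i , j) → combination μ p i j ≡ 0ℚ) (proj₂ (pair-surjective i j i≢j ij≢ab))
                         (coordinates (proj₁ (pair-surjective i j i≢j ij≢ab)))

  Face : Point N → Set
  Face x = InPWO N x × lhs13 a b x ≡ rhs13 N

  module OnFace where
    open Coordinates pair

    Candidate : Set
    Candidate = Fin 8 × Σ (Fin N × Fin N) (λ (j , k) → True (completes? j k))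

    candidate : Candidate → Point N
    candidate (o , (j , k) , _) = PivotOrder.point (a ∷ b ∷ j ∷ k ∷ []) (lookup faceScores o)

    candidate-face : ∀ c → Face (candidate c)
    candidate-face (o , (j , k) , completes) =
      InPWO-charVec (PivotOrder.order (a ∷ b ∷ j ∷ k ∷ []) (lookup faceScores o)) , Tightness.tight m (toWitness completes) (lookup faceScores o) (faceScores-tight o)

    determines : Determines Face
    determines μ p p∈F Σμ≡0 coordinates i j = by-cases i j ((i , j) ≟² (a , b))
      where
      u = combination μ p
      off-ab = combination-off-ab μ p (proj₁ ∘ p∈F) coordinates
      by-cases : ∀ i j → Dec ((i , j) ≡ (a , b)) → u i j ≡ 0ℚ
      by-cases i j (no ij≢ab) = off-ab i j ij≢ab
      by-cases _ _ (yes refl) = begin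
        u a b                                    ≡⟨ solve 1 (λ y → y := :- (:- y)) refl (u a b) ⟩
        - (- u a b)                              ≡⟨ cong -_ (lhs13-at-ab u off-ab) ⟨
        - lhs13 a b u                            ≡⟨ cong -_ (lhs13-linear a b μ p u (λ _ _ → refl)) ⟩
        - sumFin (λ t → μ t * lhs13 a b (p t))   ≡⟨ cong -_ (sumFin-cong λ t → cong (μ t *_) (proj₂ (p∈F t))) ⟩
        - sumFin (λ t → μ t * rhs13 N)           ≡⟨ cong -_ (trans (sumFin-*ʳ (rhs13 N) μ) (cong (_* rhs13 N) Σμ≡0)) ⟩
        - (0ℚ * rhs13 N)                         ≡⟨ cong -_ (ℚP.*-zeroˡ (rhs13 N)) ⟩
        0ℚ                                       ∎
        where open ≡-Reasoning

    module Annihilator (α : Fin (suc D) → ℚ) (kills : ∀ c → α · lift (candidate c) ≡ 0ℚ) where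

      rule : ∀ {j k} → Completes j k → ∀ o o′ {κ U V ds} → Move (lookup faceScores o) (lookup faceScores o′) ((κ , U , V) ∷ ds) →
        κ ≢ 0ℚ → All (λ d → weight α (proj₂ d) ≡ 0ℚ) (PivotOrder.onPairs (a ∷ b ∷ j ∷ k ∷ []) ds) →
        weight α (lookup (a ∷ b ∷ j ∷ k ∷ []) U , lookup (a ∷ b ∷ j ∷ k ∷ []) V) ≡ 0ℚ
      rule completes o o′ moves κ≢0 =
        pivot-rule pair pair-offDiagonal completes moves κ≢0 α (kills (o , _ , fromWitness completes)) (kills (o′ , _ , fromWitness completes))

      1≢0 : 1ℚ ≢ 0ℚ
      1≢0 ()
      -1≢0 : - 1ℚ ≢ 0ℚ
      -1≢0 ()

      weight-ab : weight α (a , b) ≡ 0ℚ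
      weight-ab = weight-absent α (a , b) pair-≢ab

      module _ {j k} (completes : Completes j k) where
        weight-bj : weight α (b , j) ≡ 0ℚ
        weight-bj = rule completes (F.# 0) (F.# 1) move-bj 1≢0 []
        weight-aj : weight α (a , j) ≡ 0ℚ
        weight-aj = rule completes (F.# 2) (F.# 0) move-aj 1≢0 (weight-ab ∷ [])
        weight-ba : weight α (b , a) ≡ 0ℚ
        weight-ba = rule completes (F.# 2) (F.# 3) move-ba 1≢0 (weight-bj ∷ [])
        weight-jb : weight α (j , b) ≡ 0ℚ
        weight-jb = rule completes (F.# 0) (F.# 4) move-jb 1≢0 (weight-aj ∷ [])
        weight-ka : weight α (k , a) ≡ 0ℚ
        weight-ka = rule completes (F.# 5) (F.# 6) move-ka 1≢0 (weight-aj ∷ [])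
        weight-kj : weight α (k , j) ≡ 0ℚ
        weight-kj = rule completes (F.# 5) (F.# 7) move-kj -1≢0 (weight-aj ∷ [])

      weight-offDiagonal : ∀ p q → p ≢ q → (p , q) ≢ (a , b) → weight α (p , q) ≡ 0ℚ
      weight-offDiagonal p q p≢q pq≢ab = by-cases p q p≢q pq≢ab (p F.≟ a) (p F.≟ b) (q F.≟ a) (q F.≟ b)
        where
        by-cases : ∀ p q → p ≢ q → (p , q) ≢ (a , b) → Dec (p ≡ a) → Dec (p ≡ b) → Dec (q ≡ a) → Dec (q ≡ b) →
          weight α (p , q) ≡ 0ℚ
        by-cases _ _ _   ab≢ab (yes refl) _          _          (yes refl) = ⊥-elim (ab≢ab refl)
        by-cases _ q a≢q _     (yes refl) _          _          (no q≢b)   = weight-aj (proj₂ (complete-right a≢q (q≢b ∘ sym)))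
        by-cases _ _ _   _     (no _)     (yes refl) (yes refl) _          = weight-ba (proj₂ (proj₂ some-completion))
        by-cases _ q b≢q _     (no _)     (yes refl) (no q≢a)   _          = weight-bj (proj₂ (complete-right (q≢a ∘ sym) b≢q))
        by-cases p _ _   _     (no p≢a)   (no p≢b)   (yes refl) _          = weight-ka (proj₂ (complete-left (p≢a ∘ sym) (p≢b ∘ sym)))
        by-cases p _ _   _     (no p≢a)   (no p≢b)   (no _)     (yes refl) = weight-jb (proj₂ (complete-right (p≢a ∘ sym) (p≢b ∘ sym)))
        by-cases p q p≢q _     (no p≢a)   (no p≢b)   (no q≢a)   (no q≢b)   =
          weight-kj (unique4 a≢b (q≢a ∘ sym) (p≢a ∘ sym) (q≢b ∘ sym) (p≢b ∘ sym) (p≢q ∘ sym))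

    spans : Spans candidate
    spans = spans-by-weights pair-injective candidate (F.# 0 , _ , fromWitness (proj₂ (proj₂ some-completion)))
      λ α kills r → Annihilator.weight-offDiagonal α kills _ _ (pair-offDiagonal r) (pair-≢ab r)

    face-hasDim : HasDim Face D
    face-hasDim = hasDim {S = Face} determines (searchable-× searchable-Fin (searchable-True (searchable-× searchable-Fin searchable-Fin) (uncurry completes?)))
                         candidate candidate-face spans

  module OnPolytope where

    all-pairs : Fin (suc D) → Fin N × Fin N
    all-pairs = (a , b) VF.∷ pair

    all-pairs-offDiagonal : ∀ r → proj₁ (all-pairs r) ≢ proj₂ (all-pairs r)
    all-pairs-offDiagonal zero    = a≢b
    all-pairs-offDiagonal (suc r) = pair-offDiagonal r

    all-pairs-injective : Injective _≡_ _≡_ all-pairs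
    all-pairs-injective {zero}  {zero}  _  = refl
    all-pairs-injective {zero}  {suc r} eq = ⊥-elim (pair-≢ab r (sym eq))
    all-pairs-injective {suc r} {zero}  eq = ⊥-elim (pair-≢ab r eq)
    all-pairs-injective {suc r} {suc s} eq = cong suc (pair-injective eq)

    open Coordinates all-pairs

    Candidate : Set
    Candidate = Bool × Fin N × Fin N × Fin N × Fin N

    candidate : Candidate → Point N
    candidate (t , i , j , x , y) = PivotOrder.point (i ∷ j ∷ x ∷ y ∷ []) (if t then σ-ab else σ-ba)

    determines : Determines (InPWO N)
    determines μ p p∈P Σμ≡0 coordinates i j = by-cases i j ((i , j) ≟² (a , b))
      where
      by-cases : ∀ i j → Dec ((i , j) ≡ (a , b)) → combination μ p i j ≡ 0ℚ
      by-cases _ _ (yes refl)  = coordinates zero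
      by-cases i j (no ij≢ab) = combination-off-ab μ p p∈P (coordinates ∘ suc) i j ij≢ab

    weight-offDiagonal : ∀ α → (∀ c → α · lift (candidate c) ≡ 0ℚ) → ∀ {i j} → i ≢ j → weight α (i , j) ≡ 0ℚ
    weight-offDiagonal α kills {i} {j} i≢j =
      pivot-rule all-pairs all-pairs-offDiagonal completes move-ab (λ ()) α
        (kills (true , i , j , x , y)) (kills (false , i , j , x , y)) []
      where
      x-fresh = fresh (ℕP.m≤m+n 3 (suc m)) (i ∷ j ∷ [])
      x = proj₁ x-fresh
      y-fresh = fresh (ℕP.m≤m+n 4 m) (i ∷ j ∷ x ∷ [])
      y = proj₁ y-fresh
      completes : Unique (i ∷ j ∷ x ∷ y ∷ [])
      completes = unique4 i≢j (proj₂ x-fresh A) (proj₂ y-fresh A) (proj₂ x-fresh B) (proj₂ y-fresh B) (proj₂ y-fresh J)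

    polytope-hasDim : HasDim (InPWO N) (suc D)
    polytope-hasDim = hasDim {S = InPWO N} determines
      (searchable-× searchable-Bool (searchable-× searchable-Fin (searchable-× searchable-Fin (searchable-× searchable-Fin searchable-Fin))))
      candidate (λ (t , i , j , x , y) → InPWO-charVec (PivotOrder.order (i ∷ j ∷ x ∷ y ∷ []) (if t then σ-ab else σ-ba)))
      (spans-by-weights all-pairs-injective candidate (true , a , b , a , b)
        λ α kills r → weight-offDiagonal α kills (all-pairs-offDiagonal r))

theorem13 : (n : ℕ) → 4 ℕ.≤ n → (i₁ i₂ : Fin n) → i₁ ≢ i₂ →
    FacetDefining (InPWO n) (lhs13 i₁ i₂) (rhs13 n)
theorem13 (suc (suc (suc (suc m)))) (s≤s (s≤s (s≤s (s≤s z≤n)))) i₁ i₂ i₁≢i₂ =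
  lhs13-valid m i₁≢i₂ ,
  (proj₁ face-basis zero , proj₁ (proj₂ face-basis) zero) ,
  (λ all-tight → ¬⊆-HasDim face-hasDim polytope-hasDim λ x x∈P → x∈P , all-tight x x∈P) ,
  (_ , polytope-hasDim , face-hasDim)
  where
  open Dimensions m i₁≢i₂
  open OnFace using (face-hasDim)
  open OnPolytope using (polytope-hasDim)
  face-basis = proj₁ face-hasDim
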